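{- For $i\geq 1$ and $m\geq 1$, there is a bijection $$\mathcal{R}_{n,k}^{(i)}[\deg(n)=m,\ \deg(1)=0,\ \lambda>1]\longleftrightarrow \mathcal{R}_{n,k+1}^{(i-1)}[\deg(n)=m+1,\ \deg(1)=0,\ \lambda>1].$$
   Context: A rooted labeled tree on $[n]=\{1,\dots,n\}$ has a designated root. For a node $x$, $T_x$ is the subtree consisting of $x$ and all its descendants, $\beta_T(x)$ (or $\beta(x)$) is the smallest label in $T_x$, and for a set of nodes $S$, $\beta(S)$ is its smallest label. For an edge between a node $x$ and its child $y$, the edge is proper if $x<\beta_T(y)$ and improper otherwise. $\deg(x)$ is the number of children of $x$. $\mathcal{R}_{n,k}$ is the set of rooted labeled trees on $[n]$ with exactly $k$ improper edges, and $\mathcal{R}^{(i)}_{n,k}$ is the subset of those trees for which exactly $i$ edges on the path from node $n$ to the root are proper; bracketed conditions denote the subset satisfying them. For a rooted tree $T$ on $[n]$ with $\deg_T(n)>0$, let $(n=u_1,u_2,\dots,u_t=\beta(n))$ be the path from $n$ to $\beta(n)$; the lower critical node $\lambda=\lambda(T)$ is the first node $u_j$ with $j\geq 2$ such that $u_j<\beta(T_n-T_{u_j})$, where $T_n-T_{u_j}$ denotes the set of nodes of $T_n$ not in $T_{u_j}$. -}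

module Defs where

-- Rooted labeled trees on [N], encoded on Fin N with label(x) = toℕ x + 1
-- (so comparisons of labels are comparisons of toℕ).  A rooted tree is
-- given by its parent vector P : Vec (Fin N) N, where the root is the
-- unique node with P[root] = root.  Such a vector is a rooted tree iff
-- iterating the parent map N times sends every node to the same node
-- (that node is then the root, a fixed point, and there are no other cycles).

open import Data.Nat using (ℕ; zero; suc; _<ᵇ_; _≡ᵇ_; _⊓_)
open import Data.Fin using (Fin; toℕ; fromℕ) renaming (zero to fzero)
open import Data.Fin.Properties using (_≟_)
open import Data.Vec using (Vec; lookup)
open import Data.List using (List; []; _∷_; length; foldr; map; upTo; allFin; filterᵇ)
open import Data.Bool.ListAction using (all; any)
open import Data.Bool using (Bool; true; false; _∧_; not; T)
open import Data.Maybe using (Maybe; just; nothing)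
open import Data.Product using (Σ; _×_)
open import Relation.Nullary using (does)
open import Relation.Binary.PropositionalEquality using (_≡_)

Parents : ℕ → Set
Parents N = Vec (Fin N) N

_==_ : ∀ {N} → Fin N → Fin N → Bool
x == y = does (x ≟ y)

count : ∀ {N} → (Fin N → Bool) → ℕ
count {N} p = length (filterᵇ p (allFin N))

module _ {N : ℕ} (P : Parents N) where

  par : Fin N → Fin N
  par x = lookup P x

  iter : ℕ → Fin N → Fin N
  iter zero x = x
  iter (suc j) x = par (iter j x)

  isTree : Bool
  isTree = all (λ x → all (λ y → iter N x == iter N y) (allFin N)) (allFin N)

  -- y is not the root (so (par y , y) is an edge, par y the parent of y)
  nonRoot : Fin N → Bool
  nonRoot y = not (par y == y)

  -- desc x y : y ∈ T_x  (x is an ancestor of y or x = y)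
  desc : Fin N → Fin N → Bool
  desc x y = any (λ j → iter j y == x) (upTo (suc N))

  -- minimum (0-based) label of the nodes satisfying p; N if none
  minLabel : (Fin N → Bool) → ℕ
  minLabel p = foldr _⊓_ N (map toℕ (filterᵇ p (allFin N)))

  β : Fin N → ℕ
  β x = minLabel (desc x)

  proper : Fin N → Bool
  proper y = toℕ (par y) <ᵇ β y

  improperCount : ℕ
  improperCount = count (λ y → nonRoot y ∧ not (proper y))

  deg : Fin N → ℕ
  deg x = count (λ y → nonRoot y ∧ (par y == x))

  pathProperCount : Fin N → ℕ
  pathProperCount v = count (λ y → nonRoot y ∧ desc y v ∧ proper y)

  head? : List (Fin N) → Maybe (Fin N)
  head? [] = nothing
  head? (x ∷ _) = just x

  module Critical (v : Fin N) where
    -- the node β(v) (smallest label in T_v; allFin is increasing)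
    βnode : Maybe (Fin N)
    βnode = head? (filterᵇ (desc v) (allFin N))

    -- u = u_j for some j ≥ 2 on the path (v = u_1, …, u_t = β(v))
    onPath : Fin N → Fin N → Bool
    onPath b u = desc v u ∧ not (u == v) ∧ desc u b

    critical : Fin N → Bool
    critical u = toℕ u <ᵇ minLabel (λ y → desc v y ∧ not (desc u y))

    isLambda : Fin N → Fin N → Bool
    isLambda b u = onPath b u ∧ critical u
      ∧ not (any (λ w → onPath b w ∧ not (w == u) ∧ desc w u ∧ critical w) (allFin N))

    lam : Maybe (Fin N)
    lam with βnode
    ... | nothing = nothing
    ... | just b = head? (filterᵇ (isLambda b) (allFin N))

  lambdaGt1 : Fin N → Bool
  lambdaGt1 v with Critical.lam v
  ... | nothing = false
  ... | just u = 0 <ᵇ toℕ u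

-- Trees on [suc n] (nodes Fin (suc n); node "1" is fzero, node "suc n" is fromℕ n):
-- R^{(i)}_{suc n, k}[deg(suc n) = m, deg(1) = 0, λ > 1]
R : (n k i m : ℕ) → Set
R n k i m = Σ (Parents (suc n)) λ P →
    T (isTree P)
  × improperCount P ≡ k
  × pathProperCount P (fromℕ n) ≡ i
  × deg P (fromℕ n) ≡ m
  × deg P fzero ≡ 0
  × T (lambdaGt1 P (fromℕ n))

-- Write v for the node n.  Both maps reverse a segment d = x₀, x₁ = par x₀, …, xₛ of a path to the
-- root: xₜ becomes the parent of x₍ₜ₊₁₎ and d is hung below the old parent of xₛ.  Only the edges
-- along the segment change: the subtree of d becomes the old T_{xₛ}, that of x₍ₜ₊₁₎ becomes
-- T_{xₛ} ∖ T_{xₜ}, every other subtree stays, and reversing again from xₛ restores the tree.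
-- Forward, let x_j be the first node above v whose parent edge is proper and reverse v = x₀, …, x_{j+1}.
-- Of the old edges above x₀, …, x_j only the last was proper; every new edge above x₁, …, x_{j+1} is
-- improper, because x_{j+1} lies in the new subtree and is smaller than every node of T_{x_j}.  So one
-- improper edge is gained, one proper edge leaves the path from v to the root, v gains the child x₁,
-- and x_{j+1} becomes the lower critical node.  Backward, reverse the path from λ up to v.

module Submission where

open import Defs
open import Data.Bool using (Bool; true; false; _∧_; _∨_; not; T; if_then_else_)
open import Data.Bool.ListAction using (all; any)
open import Data.Bool.Properties using (T?; T-≡; T-∧; T-∨; T-irrelevant; ∧-identityʳ; ∧-zeroʳ)
open import Data.Empty using (⊥; ⊥-elim)
open import Data.Fin using (Fin; toℕ; fromℕ) renaming (zero to fzero; suc to fsuc)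
open import Data.Fin.Properties using (_≟_; toℕ-injective; toℕ<n; ≤fromℕ; pigeonhole; 0≢1+n) renaming (suc-injective to fsuc-injective)
open import Data.List using (List; []; _∷_; length; foldr; map; allFin; filterᵇ; tabulate; upTo)
open import Data.List.Membership.Propositional using (_∈_; lose)
open import Data.List.Membership.Propositional.Properties using (∈-allFin; ∈-filter⁺; ∈-filter⁻; ∈-map⁺; ∈-map⁻; foldr-selective)
open import Data.List.Properties using (filter-none; filter-some; filter-≐)
open import Data.List.Relation.Unary.All as All using (All; []; _∷_)
open import Data.List.Relation.Unary.All.Properties using (all⁺; all⁻) renaming (tabulate⁺ to All-tabulate⁺; tabulate⁻ to All-tabulate⁻)
open import Data.List.Relation.Unary.Any using (here; there)
open import Data.List.Relation.Unary.Any.Properties using (any⁺; any⁻; applyUpTo⁺; applyUpTo⁻) renaming (tabulate⁺ to Any-tabulate⁺; tabulate⁻ to Any-tabulate⁻)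
open import Data.Maybe using (Maybe; just; nothing; maybe′)
import Data.Maybe as Maybe
open import Data.Maybe.Properties using (just-injective)
open import Data.Nat using (ℕ; zero; suc; _+_; _*_; _∸_; _≤_; _<_; _⊓_; _<ᵇ_; z≤n; s≤s; z<s; >-nonZero)
open import Data.Nat.Induction using (<-rec)
open import Data.Nat.Properties using (_≤?_; ≤-refl; ≤-reflexive; ≤-trans; ≤-pred; <-trans; <-≤-trans; <-irrefl; <-cmp; <⇒≤; <⇒≢; <⇒≱; ≤∧≢⇒<; ≮⇒≥; ≰⇒>; 1+n≰n; 1+n≢0; n<1+n; n≤1+n; m≤n⇒m≤1+n; m≤n⇒m<n∨m≡n; n≤0⇒n≡0; <ᵇ⇒<; <⇒<ᵇ; ≡-irrelevant; +-comm; +-assoc; +-suc; +-identityʳ; +-cancelʳ-≡; +-commutativeSemigroup; m≤m+n; m≤n+m; m≤m*n; m∸n≤m; n∸n≡0; m∸n+n≡m; m+[n∸m]≡n; m+n∸n≡m; m∸[m∸n]≡n; +-∸-assoc; m<n⇒0<n∸m; ∸-monoʳ-<; ⊓-glb; ⊓-sel; m⊓n≤m; m⊓n≤n)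
open import Algebra.Properties.CommutativeSemigroup +-commutativeSemigroup using (xy∙z≈zy∙x) renaming (interchange to +-interchange)
open import Data.Product using (∃; _×_; _,_; proj₁; proj₂)
open import Data.Sum using (_⊎_; inj₁; inj₂)
import Data.Vec as Vec
open import Data.Vec.Properties using (lookup∘tabulate; tabulate-cong; tabulate∘lookup)
open import Function using (_∘_; id)
open import Function.Bundles using (Equivalence; _⤖_; mk↔ₛ′)
open import Function.Properties.Inverse using (↔⇒⤖)
open import Relation.Binary.Definitions using (tri<; tri≈; tri>)
open import Relation.Binary.PropositionalEquality using (_≡_; _≢_; refl; sym; trans; cong; cong₂; subst; module ≡-Reasoning)
open import Relation.Nullary using (¬_; Dec; yes; no; contradiction)

open ≡-Reasoning

∧-intro : ∀ {a b} → T a → T b → T (a ∧ b)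
∧-intro p q = Equivalence.from T-∧ (p , q)

∧-elimˡ : ∀ {a b} → T (a ∧ b) → T a
∧-elimˡ = proj₁ ∘ Equivalence.to T-∧

∧-elimʳ : ∀ {a b} → T (a ∧ b) → T b
∧-elimʳ {a} = proj₂ ∘ Equivalence.to (T-∧ {a})

not-intro : ∀ {a} → ¬ T a → T (not a)
not-intro {false} _ = _
not-intro {true} ¬a = ¬a _

not-elim : ∀ {a} → T (not a) → ¬ T a
not-elim {false} _ ()

∨-introˡ : ∀ {a b} → T a → T (a ∨ b)
∨-introˡ p = Equivalence.from T-∨ (inj₁ p)

∨-introʳ : ∀ {a b} → T b → T (a ∨ b)
∨-introʳ {a} q = Equivalence.from (T-∨ {a}) (inj₂ q)

T-ext : ∀ {a b} → (T a → T b) → (T b → T a) → a ≡ b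
T-ext {false} {false} _ _ = refl
T-ext {false} {true} _ g = ⊥-elim (g _)
T-ext {true} {false} f _ = ⊥-elim (f _)
T-ext {true} {true} _ _ = refl

T⇒≡true : ∀ {a} → T a → a ≡ true
T⇒≡true = Equivalence.to T-≡

¬T⇒≡false : ∀ {a} → ¬ T a → a ≡ false
¬T⇒≡false {false} _ = refl
¬T⇒≡false {true} ¬a = ⊥-elim (¬a _)

if-T : ∀ {A : Set} {b} {u v : A} → T b → (if b then u else v) ≡ u
if-T {b = true} _ = refl

if-¬T : ∀ {A : Set} {b} {u v : A} → ¬ T b → (if b then u else v) ≡ v
if-¬T {b = b} ¬b rewrite ¬T⇒≡false ¬b = refl

module _ {N : ℕ} {x y : Fin N} where

  ==⇒≡ : T (x == y) → x ≡ y
  ==⇒≡ h with x ≟ y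
  ... | yes x≡y = x≡y

  ≡⇒== : x ≡ y → T (x == y)
  ≡⇒== x≡y with x ≟ y
  ... | yes _ = _
  ... | no x≢y = x≢y x≡y

==-refl : ∀ {N} (x : Fin N) → T (x == x)
==-refl x = ≡⇒== {x = x} {y = x} refl

-- Counting

indicator : Bool → ℕ
indicator b = if b then 1 else 0

indicator-true : ∀ {b} → T b → indicator b ≡ 1
indicator-true {true} _ = refl

indicator-false : ∀ {b} → ¬ T b → indicator b ≡ 0
indicator-false {b} ¬b rewrite ¬T⇒≡false ¬b = refl

length-filterᵇ-tabulate : ∀ {A : Set} {M} (p : A → Bool) (f : Fin M → A) →
  length (filterᵇ p (tabulate f)) ≡ count (p ∘ f)
length-filterᵇ-tabulate {M = zero} p f = refl
length-filterᵇ-tabulate {M = suc M} p f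
  with p (f fzero) | length-filterᵇ-tabulate p (f ∘ fsuc) | length-filterᵇ-tabulate (p ∘ f) fsuc
... | true | eq₁ | eq₂ = cong suc (trans eq₁ (sym eq₂))
... | false | eq₁ | eq₂ = trans eq₁ (sym eq₂)

count-suc : ∀ {N} (p : Fin (suc N) → Bool) → count p ≡ indicator (p fzero) + count (p ∘ fsuc)
count-suc p with p fzero
... | true = cong suc (length-filterᵇ-tabulate p fsuc)
... | false = length-filterᵇ-tabulate p fsuc

count-+ : ∀ {N} (p q r : Fin N → Bool) →
  (∀ y → indicator (p y) ≡ indicator (q y) + indicator (r y)) → count p ≡ count q + count r
count-+ {zero} p q r split = refl
count-+ {suc N} p q r split = begin
  count p                                             ≡⟨ count-suc p ⟩
  indicator (p fzero) + count (p ∘ fsuc)              ≡⟨ cong₂ _+_ (split fzero) (count-+ _ _ _ (split ∘ fsuc)) ⟩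
  (q₀ + r₀) + (count (q ∘ fsuc) + count (r ∘ fsuc))   ≡⟨ +-interchange q₀ r₀ _ _ ⟩
  (q₀ + count (q ∘ fsuc)) + (r₀ + count (r ∘ fsuc))   ≡⟨ sym (cong₂ _+_ (count-suc q) (count-suc r)) ⟩
  count q + count r                                   ∎
  where
  q₀ r₀ : ℕ
  q₀ = indicator (q fzero)
  r₀ = indicator (r fzero)

count-split : ∀ {N} (p q : Fin N → Bool) → count p ≡ count (λ y → p y ∧ q y) + count (λ y → p y ∧ not (q y))
count-split p q = count-+ _ _ _ split
  where
  split : ∀ y → indicator (p y) ≡ indicator (p y ∧ q y) + indicator (p y ∧ not (q y))
  split y with p y | q y
  ... | true | true = refl
  ... | true | false = refl
  ... | false | _ = refl

filterᵇ-cong : ∀ {A : Set} {p q : A → Bool} → (∀ y → p y ≡ q y) → ∀ xs → filterᵇ p xs ≡ filterᵇ q xs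
filterᵇ-cong {p = p} {q} p≗q = filter-≐ (T? ∘ p) (T? ∘ q) ((λ {y} → subst T (p≗q y)) , λ {y} → subst T (sym (p≗q y)))

count-cong : ∀ {N} {p q : Fin N → Bool} → (∀ y → p y ≡ q y) → count p ≡ count q
count-cong {N} p≗q = cong length (filterᵇ-cong p≗q (allFin N))

count-none : ∀ {N} (p : Fin N → Bool) → (∀ y → ¬ T (p y)) → count p ≡ 0
count-none p none = cong length (filter-none (T? ∘ p) (All-tabulate⁺ none))

count≡0⇒¬ : ∀ {N} (p : Fin N → Bool) → count p ≡ 0 → ∀ y → ¬ T (p y)
count≡0⇒¬ p c≡0 y py = <⇒≢ (filter-some (T? ∘ p) (lose (∈-allFin y) py)) (sym c≡0)

count≢0⇒∃ : ∀ {N} (p : Fin N → Bool) → count p ≢ 0 → ∃ λ y → T (p y)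
count≢0⇒∃ {N} p c≢0 with filterᵇ p (allFin N) in eq
... | [] = ⊥-elim (c≢0 refl)
... | y ∷ _ = y , proj₂ (∈-filter⁻ (T? ∘ p) {xs = allFin N} (subst (y ∈_) (sym eq) (here refl)))

count-only : ∀ {N} (p : Fin N → Bool) (z : Fin N) → (∀ y → T (p y) → y ≡ z) → count p ≡ indicator (p z)
count-only {suc N} p fzero only = begin
  count p                                ≡⟨ count-suc p ⟩
  indicator (p fzero) + count (p ∘ fsuc)  ≡⟨ cong (indicator (p fzero) +_) (count-none (p ∘ fsuc) λ y py → 0≢1+n (sym (only (fsuc y) py))) ⟩
  indicator (p fzero) + 0                 ≡⟨ +-identityʳ _ ⟩
  indicator (p fzero)                     ∎
count-only {suc N} p (fsuc z) only = begin
  count p                                ≡⟨ count-suc p ⟩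
  indicator (p fzero) + count (p ∘ fsuc)  ≡⟨ cong₂ _+_ (indicator-false λ p0 → 0≢1+n (only fzero p0)) (count-only (p ∘ fsuc) z λ y py → fsuc-injective (only (fsuc y) py)) ⟩
  indicator (p (fsuc z))                  ∎

count-∧-== : ∀ {N} (g : Fin N → Bool) (z : Fin N) → count (λ y → g y ∧ (y == z)) ≡ indicator (g z)
count-∧-== g z = trans (count-only _ z λ y h → ==⇒≡ (∧-elimʳ {g y} h)) (cong indicator (trans (cong (g z ∧_) (T⇒≡true (==-refl z))) (∧-identityʳ (g z))))

foldr-⊓-≤ : ∀ {t n ns} → n ∈ ns → foldr _⊓_ t ns ≤ n
foldr-⊓-≤ (here refl) = m⊓n≤m _ _
foldr-⊓-≤ (there n∈ns) = ≤-trans (m⊓n≤n _ _) (foldr-⊓-≤ n∈ns)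

≤-foldr-⊓ : ∀ {k t ns} → k ≤ t → All (k ≤_) ns → k ≤ foldr _⊓_ t ns
≤-foldr-⊓ k≤t [] = k≤t
≤-foldr-⊓ k≤t (k≤n ∷ k≤ns) = ⊓-glb k≤n (≤-foldr-⊓ k≤t k≤ns)

module _ {N : ℕ} (P : Parents N) (p : Fin N → Bool) where

  private
    labels : List ℕ
    labels = map toℕ (filterᵇ p (allFin N))

    ∈-labels⁻ : ∀ {k} → k ∈ labels → ∃ λ y → T (p y) × k ≡ toℕ y
    ∈-labels⁻ k∈ with ∈-map⁻ toℕ k∈
    ... | y , y∈ , refl = y , proj₂ (∈-filter⁻ (T? ∘ p) {xs = allFin N} y∈) , refl

  minLabel-≤ : ∀ {y} → T (p y) → minLabel P p ≤ toℕ y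
  minLabel-≤ py = foldr-⊓-≤ (∈-map⁺ toℕ (∈-filter⁺ (T? ∘ p) (∈-allFin _) py))

  ≤-minLabel : ∀ {k} → k ≤ N → (∀ y → T (p y) → k ≤ toℕ y) → k ≤ minLabel P p
  ≤-minLabel k≤N bound = ≤-foldr-⊓ k≤N (All.tabulate λ k∈ → let (y , py , eq) = ∈-labels⁻ k∈ in subst (_ ≤_) (sym eq) (bound y py))

  <ᵇ-minLabel⁺ : ∀ {k} → k < N → (∀ y → T (p y) → k < toℕ y) → T (k <ᵇ minLabel P p)
  <ᵇ-minLabel⁺ k<N bound = <⇒<ᵇ (≤-minLabel k<N bound)

  <ᵇ-minLabel⁻ : ∀ {k y} → T (k <ᵇ minLabel P p) → T (p y) → k < toℕ y
  <ᵇ-minLabel⁻ {k} k<min py = <-≤-trans (<ᵇ⇒< k _ k<min) (minLabel-≤ py)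

  ¬<ᵇ-minLabel⇒∃ : ∀ {k} → k < N → ¬ T (k <ᵇ minLabel P p) → ∃ λ y → T (p y) × toℕ y ≤ k
  ¬<ᵇ-minLabel⇒∃ {k} k<N k≮min with foldr-selective ⊓-sel N labels
  ... | inj₁ min≡N = ⊥-elim (k≮min (<⇒<ᵇ (subst (k <_) (sym min≡N) k<N)))
  ... | inj₂ min∈ with ∈-labels⁻ min∈
  ...   | y , py , eq = y , py , subst (_≤ k) eq (≮⇒≥ (k≮min ∘ <⇒<ᵇ))

minLabel-cong : ∀ {N} (P Q : Parents N) {p q : Fin N → Bool} → (∀ y → p y ≡ q y) → minLabel P p ≡ minLabel Q q
minLabel-cong {N} P Q p≗q = cong (foldr _⊓_ N ∘ map toℕ) (filterᵇ-cong p≗q (allFin N))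

module _ {N : ℕ} (P : Parents N) (f : Fin N → Bool) where

  head?-filterᵇ-tabulate : ∀ {M} (g : Fin M → Fin N) {b} → head? P (filterᵇ f (tabulate g)) ≡ just b →
    ∃ λ i → g i ≡ b × T (f (g i)) × (∀ i′ → toℕ i′ < toℕ i → ¬ T (f (g i′)))
  head?-filterᵇ-tabulate {suc M} g eq with f (g fzero) in f₀
  ... | true = fzero , just-injective eq , subst T (sym f₀) _ , λ _ ()
  ... | false with head?-filterᵇ-tabulate (g ∘ fsuc) eq
  ...   | i , gi≡b , fgi , least = fsuc i , gi≡b , fgi , λ where
          fzero _ → subst T f₀
          (fsuc i′) (s≤s i′<i) → least i′ i′<i

  head?-filterᵇ-least : ∀ {b} → head? P (filterᵇ f (allFin N)) ≡ just b → T (f b) × (∀ y → T (f y) → toℕ b ≤ toℕ y)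
  head?-filterᵇ-least eq with head?-filterᵇ-tabulate id eq
  ... | b , refl , fb , least = fb , λ y fy → ≮⇒≥ λ y<b → least y y<b fy

  head?-filterᵇ-∃ : ∀ {y} → T (f y) → ∃ λ b → head? P (filterᵇ f (allFin N)) ≡ just b
  head?-filterᵇ-∃ {y} fy with filterᵇ f (allFin N) in eq
  ... | [] = contradiction (subst (y ∈_) eq (∈-filter⁺ (T? ∘ f) (∈-allFin y) fy)) λ ()
  ... | b ∷ _ = b , refl

  head?-filterᵇ-unique : ∀ {z} → T (f z) → (∀ y → T (f y) → y ≡ z) → head? P (filterᵇ f (allFin N)) ≡ just z
  head?-filterᵇ-unique fz unique with head?-filterᵇ-∃ fz
  ... | b , eq = trans eq (cong just (unique b (proj₁ (head?-filterᵇ-least eq))))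

findFirst : (ℕ → Bool) → ℕ → Maybe ℕ
findFirst f zero = nothing
findFirst f (suc K) = if f 0 then just 0 else Maybe.map suc (findFirst (f ∘ suc) K)

findFirst-just⇒least : ∀ f K {j} → findFirst f K ≡ just j → T (f j) × j < K × (∀ t → t < j → ¬ T (f t))
findFirst-just⇒least f (suc K) eq with f 0 in f₀
findFirst-just⇒least f (suc K) refl | true = subst T (sym f₀) _ , s≤s z≤n , λ _ ()
... | false with findFirst (f ∘ suc) K in eq′
findFirst-just⇒least f (suc K) refl | false | just j with findFirst-just⇒least (f ∘ suc) K eq′
... | fj , j<K , least = fj , s≤s j<K , λ where
        zero _ → subst T f₀
        (suc t) (s≤s t<j) → least t t<j

findFirst-∃ : ∀ f K {t} → T (f t) → t < K → ∃ λ j → findFirst f K ≡ just j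
findFirst-∃ f (suc K) {t} ft t<K with f 0 in f₀
... | true = 0 , refl
findFirst-∃ f (suc K) {zero} ft t<K | false = ⊥-elim (subst T f₀ ft)
findFirst-∃ f (suc K) {suc t} ft (s≤s t<K) | false with findFirst-∃ (f ∘ suc) K ft t<K
... | j , eq rewrite eq = suc j , refl

findFirst-least⇒just : ∀ f K {j} → T (f j) → j < K → (∀ t → t < j → ¬ T (f t)) → findFirst f K ≡ just j
findFirst-least⇒just f K {j} fj j<K least with findFirst-∃ f K fj j<K
... | j′ , eq with findFirst-just⇒least f K eq | <-cmp j j′
...   | _ , _ , least′ | tri< j<j′ _ _ = ⊥-elim (least′ j j<j′ fj)
...   | _ , _ , _ | tri≈ _ refl _ = eq
...   | fj′ , _ , _ | tri> _ _ j′<j = ⊥-elim (least j′ j′<j fj′)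

findFirst-none : ∀ f K → (∀ t → t < K → ¬ T (f t)) → findFirst f K ≡ nothing
findFirst-none f zero none = refl
findFirst-none f (suc K) none with f 0 in f₀
... | true = ⊥-elim (none 0 (s≤s z≤n) (subst T (sym f₀) _))
... | false = cong (Maybe.map suc) (findFirst-none (f ∘ suc) K λ t t<K → none (suc t) (s≤s t<K))

sumUpTo : (ℕ → ℕ) → ℕ → ℕ
sumUpTo h zero = h 0
sumUpTo h (suc K) = sumUpTo h K + h (suc K)

sumUpTo-zeros : ∀ h K → (∀ t → t ≤ K → h t ≡ 0) → sumUpTo h K ≡ 0
sumUpTo-zeros h zero zeros = zeros 0 z≤n
sumUpTo-zeros h (suc K) zeros = cong₂ _+_ (sumUpTo-zeros h K λ t t≤K → zeros t (m≤n⇒m≤1+n t≤K)) (zeros (suc K) ≤-refl)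

sumUpTo-ones : ∀ h K → (∀ t → t ≤ K → h t ≡ 1) → sumUpTo h K ≡ suc K
sumUpTo-ones h zero ones = ones 0 z≤n
sumUpTo-ones h (suc K) ones =
  trans (cong₂ _+_ (sumUpTo-ones h K λ t t≤K → ones t (m≤n⇒m≤1+n t≤K)) (ones (suc K) ≤-refl)) (+-comm (suc K) 1)

sumUpTo-shift : ∀ h K → sumUpTo h (suc K) ≡ h 0 + sumUpTo (h ∘ suc) K
sumUpTo-shift h zero = refl
sumUpTo-shift h (suc K) = trans (cong (_+ h (suc (suc K))) (sumUpTo-shift h K)) (+-assoc (h 0) _ _)

sumUpTo-ones-then-0 : ∀ h K → (∀ t → t < K → h t ≡ 1) → h K ≡ 0 → sumUpTo h K ≡ K
sumUpTo-ones-then-0 h zero _ last = last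
sumUpTo-ones-then-0 h (suc K) ones last =
  trans (cong₂ _+_ (sumUpTo-ones h K λ t t≤K → ones t (s≤s t≤K)) last) (+-identityʳ _)

sumUpTo-zeros-then-1 : ∀ h K → (∀ t → t < K → h t ≡ 0) → h K ≡ 1 → sumUpTo h K ≡ 1
sumUpTo-zeros-then-1 h zero _ last = last
sumUpTo-zeros-then-1 h (suc K) zeros last = cong₂ _+_ (sumUpTo-zeros h K λ t t≤K → zeros t (s≤s t≤K)) last

sumUpTo-0-then-ones : ∀ h K → h 0 ≡ 0 → (∀ t → 1 ≤ t → t ≤ K → h t ≡ 1) → sumUpTo h K ≡ K
sumUpTo-0-then-ones h zero first _ = first
sumUpTo-0-then-ones h (suc K) first ones = trans (sumUpTo-shift h K) (cong₂ _+_ first (sumUpTo-ones (h ∘ suc) K λ t t≤K → ones (suc t) (s≤s z≤n) (s≤s t≤K)))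

sumUpTo-1-then-zeros : ∀ h K → h 0 ≡ 1 → (∀ t → 1 ≤ t → t ≤ K → h t ≡ 0) → sumUpTo h K ≡ 1
sumUpTo-1-then-zeros h zero first _ = first
sumUpTo-1-then-zeros h (suc K) first zeros = trans (sumUpTo-shift h K) (cong₂ _+_ first (sumUpTo-zeros (h ∘ suc) K λ t t≤K → zeros (suc t) (s≤s z≤n) (s≤s t≤K)))

-- Ancestors

Ancestor : ∀ {N} → Parents N → Fin N → Fin N → Set
Ancestor P x y = ∃ λ j → iter P j y ≡ x

module _ {N : ℕ} (P : Parents N) where

  iter-+ : ∀ a b x → iter P (a + b) x ≡ iter P a (iter P b x)
  iter-+ zero b x = refl
  iter-+ (suc a) b x = cong (par P) (iter-+ a b x)

  iter-suc : ∀ j x → iter P (suc j) x ≡ iter P j (par P x)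
  iter-suc j x = trans (cong (λ k → iter P k x) (+-comm 1 j)) (iter-+ j 1 x)

  iter-∸ : ∀ {i j} x → i ≤ j → iter P (j ∸ i) (iter P i x) ≡ iter P j x
  iter-∸ {i} {j} x i≤j = trans (sym (iter-+ (j ∸ i) i x)) (cong (λ k → iter P k x) (m∸n+n≡m i≤j))

  iter-fixed : ∀ {r} → par P r ≡ r → ∀ j → iter P j r ≡ r
  iter-fixed r-fixed zero = refl
  iter-fixed r-fixed (suc j) = trans (cong (par P) (iter-fixed r-fixed j)) r-fixed

  iter-periodic : ∀ {q y} → iter P q y ≡ y → ∀ k → iter P (k * q) y ≡ y
  iter-periodic periodic zero = refl
  iter-periodic {q} {y} periodic (suc k) =
    trans (iter-+ q (k * q) y) (trans (cong (iter P q) (iter-periodic periodic k)) periodic)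

  iter-≥ : ∀ {r} → par P r ≡ r → ∀ {J K x} → iter P J x ≡ r → J ≤ K → iter P K x ≡ r
  iter-≥ r-fixed {J} {K} {x} reached J≤K =
    trans (sym (iter-∸ x J≤K)) (trans (cong (iter P (K ∸ J)) reached) (iter-fixed r-fixed (K ∸ J)))

  Ancestor-refl : ∀ x → Ancestor P x x
  Ancestor-refl x = 0 , refl

  Ancestor-par : ∀ y → Ancestor P (par P y) y
  Ancestor-par y = 1 , refl

  Ancestor-trans : ∀ {x y z} → Ancestor P x y → Ancestor P y z → Ancestor P x z
  Ancestor-trans {z = z} (a , ya≡x) (b , zb≡y) = a + b , trans (iter-+ a b z) (trans (cong (iter P a) zb≡y) ya≡x)

  Ancestor-via-par : ∀ {x y} → Ancestor P x (par P y) → Ancestor P x y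
  Ancestor-via-par {y = y} (j , eq) = suc j , trans (iter-suc j y) eq

  Ancestor-ind : ∀ {z} (Ψ : Fin N → Set) → Ψ z → (∀ y → Ψ (par P y) → Ψ y) → ∀ {y} → Ancestor P z y → Ψ y
  Ancestor-ind {z} Ψ base step (j , eq) = go j eq
    where
    go : ∀ j {y} → iter P j y ≡ z → Ψ y
    go zero refl = base
    go (suc j) {y} eq = step y (go j (trans (sym (iter-suc j y)) eq))

  -- Pigeonhole: among iter 0 x, …, iter N x two coincide, so the walk from x is eventually
  -- periodic; as it also reaches the fixed point r, it is at r after at most N steps.
  iter-N-reaches : ∀ {r} → par P r ≡ r → ∀ {x} → Ancestor P r x → iter P N x ≡ r
  iter-N-reaches {r} r-fixed {x} (J , reached) with pigeonhole ≤-refl (λ (i : Fin (suc N)) → iter P (toℕ i) x)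
  ... | i , j , i<j , collide = iter-≥ r-fixed y≡r (≤-pred (toℕ<n i))
    where
    q : ℕ
    q = toℕ j ∸ toℕ i
    y : Fin N
    y = iter P (toℕ i) x
    periodic : iter P q y ≡ y
    periodic = trans (iter-∸ x (<⇒≤ i<j)) (sym collide)
    y≡r : iter P (toℕ i) x ≡ r
    y≡r = trans (sym (iter-periodic periodic J))
            (trans (sym (iter-+ (J * q) (toℕ i) x))
              (iter-≥ r-fixed reached (≤-trans (m≤m*n J q {{>-nonZero (m<n⇒0<n∸m i<j)}}) (m≤m+n (J * q) (toℕ i)))))

  isTree-intro : ∀ r → par P r ≡ r → (∀ x → Ancestor P r x) → T (isTree P)
  isTree-intro r r-fixed r-above = all⁻ _ (All-tabulate⁺ λ x → all⁻ _ (All-tabulate⁺ λ y →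
    ≡⇒== (trans (iter-N-reaches r-fixed (r-above x)) (sym (iter-N-reaches r-fixed (r-above y))))))

module RootedTree {n : ℕ} (P : Parents (suc n)) (tree : T (isTree P)) where

  private
    N : ℕ
    N = suc n

  root : Fin N
  root = iter P N fzero

  iter-N : ∀ x → iter P N x ≡ root
  iter-N x = ==⇒≡ (All-tabulate⁻ {f = id} (all⁺ _ (allFin N) (All-tabulate⁻ {f = id} row-x x)) fzero)
    where
    row-x : All (λ x → T (all (λ y → iter P N x == iter P N y) (allFin N))) (allFin N)
    row-x = all⁺ (λ x → all (λ y → iter P N x == iter P N y) (allFin N)) (allFin N) tree

  par-root : par P root ≡ root
  par-root = trans (iter-suc P N fzero) (iter-N (par P fzero))

  iter-root : ∀ j → iter P j root ≡ root
  iter-root = iter-fixed P par-root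

  Ancestor-root : ∀ y → Ancestor P root y
  Ancestor-root y = N , iter-N y

  iter-≥N : ∀ {j} y → N ≤ j → iter P j y ≡ root
  iter-≥N y N≤j = iter-≥ P par-root (iter-N y) N≤j

  Ancestor-≤N : ∀ {x y} → Ancestor P x y → ∃ λ j → j ≤ N × iter P j y ≡ x
  Ancestor-≤N {x} {y} (j , yj≡x) with j ≤? N
  ... | yes j≤N = j , j≤N , yj≡x
  ... | no j≰N = N , ≤-refl , trans (iter-N y) (trans (sym (iter-≥N y (<⇒≤ (≰⇒> j≰N)))) yj≡x)

  desc⇒Ancestor : ∀ {x y} → T (desc P x y) → Ancestor P x y
  desc⇒Ancestor h with applyUpTo⁻ id (any⁻ _ (upTo (suc N)) h)
  ... | j , _ , yj≡x = j , ==⇒≡ yj≡x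

  Ancestor⇒desc : ∀ {x y} → Ancestor P x y → T (desc P x y)
  Ancestor⇒desc {x} {y} above with Ancestor-≤N above
  ... | j , j≤N , yj≡x = any⁺ (λ k → iter P k y == x) (applyUpTo⁺ id (≡⇒== yj≡x) (s≤s j≤N))

  fixed⇒root : ∀ {y} → par P y ≡ y → y ≡ root
  fixed⇒root {y} y-fixed = trans (sym (iter-fixed P y-fixed N)) (iter-N y)

  periodic⇒root : ∀ {q y} → 0 < q → iter P q y ≡ y → y ≡ root
  periodic⇒root {q} {y} 0<q periodic =
    trans (sym (iter-periodic P {q} periodic N)) (iter-≥ P par-root (iter-N y) (m≤m*n N q {{>-nonZero 0<q}}))

  Ancestor-of-root : ∀ {x} → Ancestor P x root → x ≡ root
  Ancestor-of-root (j , eq) = trans (sym eq) (iter-root j)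

  Ancestor-antisym : ∀ {x y} → Ancestor P x y → Ancestor P y x → x ≡ y
  Ancestor-antisym (zero , y≡x) _ = sym y≡x
  Ancestor-antisym {x} {y} (suc a , ya≡x) (b , xb≡y) = trans x≡root (sym (Ancestor-of-root (b , trans (cong (iter P b) (sym x≡root)) xb≡y)))
    where
    x≡root : x ≡ root
    x≡root = periodic⇒root {suc a + b} z<s (trans (iter-+ P (suc a) b x) (trans (cong (iter P (suc a)) xb≡y) ya≡x))

  Ancestor-linear : ∀ {x y z} → Ancestor P x z → Ancestor P y z → Ancestor P y x ⊎ Ancestor P x y
  Ancestor-linear {x} {y} {z} (a , za≡x) (b , zb≡y) with a ≤? b
  ... | yes a≤b = inj₁ (b ∸ a , trans (cong (iter P (b ∸ a)) (sym za≡x)) (trans (iter-∸ P z a≤b) zb≡y))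
  ... | no a≰b = inj₂ (a ∸ b , trans (cong (iter P (a ∸ b)) (sym zb≡y)) (trans (iter-∸ P z (<⇒≤ (≰⇒> a≰b))) za≡x))

  Ancestor-strict⇒par : ∀ {x y} → Ancestor P x y → x ≢ y → Ancestor P x (par P y)
  Ancestor-strict⇒par (zero , y≡x) x≢y = ⊥-elim (x≢y (sym y≡x))
  Ancestor-strict⇒par {y = y} (suc j , eq) _ = j , trans (sym (iter-suc P j y)) eq

  nonRoot⇒≢root : ∀ {y} → T (nonRoot P y) → y ≢ root
  nonRoot⇒≢root h refl = not-elim h (≡⇒== par-root)

  ≢root⇒nonRoot : ∀ {y} → y ≢ root → T (nonRoot P y)
  ≢root⇒nonRoot y≢root = not-intro (y≢root ∘ fixed⇒root ∘ ==⇒≡)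

  ¬nonRoot⇒≡root : ∀ {y} → ¬ T (nonRoot P y) → y ≡ root
  ¬nonRoot⇒≡root {y} h with y ≟ root
  ... | yes y≡root = y≡root
  ... | no y≢root = ⊥-elim (h (≢root⇒nonRoot y≢root))

  nonRoot⇒par≢ : ∀ {y} → T (nonRoot P y) → par P y ≢ y
  nonRoot⇒par≢ h = not-elim h ∘ ≡⇒==

  nonRoot-iter⇒<N : ∀ {j y} → T (nonRoot P (iter P j y)) → j < N
  nonRoot-iter⇒<N {j} {y} h = ≰⇒> λ N≤j → nonRoot⇒≢root h (iter-≥N y N≤j)

-- Reversing a path

-- improperCount P, pathProperCount P v and deg P x are, by definition, count (isImproper P),
-- count (isProperOnPathFrom P v) and count (isChild P x).
isImproper : ∀ {N} → Parents N → Fin N → Bool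
isImproper P y = nonRoot P y ∧ not (proper P y)

isProperOnPathFrom : ∀ {N} → Parents N → Fin N → Fin N → Bool
isProperOnPathFrom P v y = nonRoot P y ∧ desc P y v ∧ proper P y

isChild : ∀ {N} → Parents N → Fin N → Fin N → Bool
isChild P x y = nonRoot P y ∧ (par P y == x)

hasProperEdge : ∀ {N} → Parents N → Fin N → Bool
hasProperEdge P y = nonRoot P y ∧ proper P y

¬isChild-self : ∀ {N} (P : Parents N) y → ¬ T (isChild P y y)
¬isChild-self P y h = not-elim (∧-elimˡ h) (∧-elimʳ {nonRoot P y} h)

module _ {N : ℕ} (P : Parents N) (d : Fin N) where

  onPathUpTo : ℕ → Fin N → Bool
  onPathUpTo zero y = y == d
  onPathUpTo (suc t) y = onPathUpTo t y ∨ (y == iter P (suc t) d)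

  -- The search finds the t with y = x₍ₜ₊₁₎, whose new parent is xₜ; d becomes the root if xₛ was the root.
  reversedParent : ℕ → Fin N → Fin N
  reversedParent s y =
    if y == d then (if nonRoot P (iter P s d) then par P (iter P s d) else d)
    else maybe′ (λ t → iter P t d) (par P y) (findFirst (λ t → y == iter P (suc t) d) s)

  reversePath : ℕ → Parents N
  reversePath s = Vec.tabulate (reversedParent s)

module PathReversal {n : ℕ} (P : Parents (suc n)) (tree : T (isTree P)) (d : Fin (suc n)) (s : ℕ)
                    (below-root : ∀ t → t < s → T (nonRoot P (iter P t d))) where

  open RootedTree P tree

  private
    N : ℕ
    N = suc n

  x : ℕ → Fin N
  x t = iter P t d

  a : Fin N
  a = x s

  Q : Parents N
  Q = reversePath P d s

  x-distinct : ∀ {t u} → t < u → u ≤ s → x t ≢ x u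
  x-distinct {t} {u} t<u u≤s xt≡xu = nonRoot⇒≢root (below-root t (<-≤-trans t<u u≤s))
    (periodic⇒root (m<n⇒0<n∸m t<u) (trans (iter-∸ P d (<⇒≤ t<u)) (sym xt≡xu)))

  x-injective : ∀ {t u} → t ≤ s → u ≤ s → x t ≡ x u → t ≡ u
  x-injective {t} {u} t≤s u≤s xt≡xu with <-cmp t u
  ... | tri< t<u _ _ = ⊥-elim (x-distinct t<u u≤s xt≡xu)
  ... | tri≈ _ t≡u _ = t≡u
  ... | tri> _ _ u<t = ⊥-elim (x-distinct u<t t≤s (sym xt≡xu))

  x-Ancestor : ∀ {t u} → u ≤ t → Ancestor P (x t) (x u)
  x-Ancestor {t} {u} u≤t = t ∸ u , iter-∸ P d u≤t

  x-Ancestor⁻ : ∀ {t u} → t ≤ s → u ≤ s → Ancestor P (x t) (x u) → u ≤ t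
  x-Ancestor⁻ t≤s u≤s above = ≮⇒≥ λ t<u → x-distinct t<u u≤s (Ancestor-antisym above (x-Ancestor (<⇒≤ t<u)))

  Ancestor-of-x : ∀ {z t} → Ancestor P z (x t) → (∃ λ v → t ≤ v × v ≤ s × z ≡ x v) ⊎ Ancestor P z (par P a)
  Ancestor-of-x {z} {t} (j , eq) with j + t ≤? s
  ... | yes j+t≤s = inj₁ (j + t , m≤n+m t j , j+t≤s , trans (sym eq) (sym (iter-+ P j t d)))
  ... | no j+t≰s = inj₂ (j + t ∸ suc s , trans (iter-∸ P d (≰⇒> j+t≰s)) (trans (iter-+ P j t d) eq))

  onPath : Fin N → Bool
  onPath = onPathUpTo P d s

  OnPath : Fin N → Set
  OnPath y = T (onPath y)

  onPathUpTo⁻ : ∀ K {y} → T (onPathUpTo P d K y) → ∃ λ t → t ≤ K × y ≡ x t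
  onPathUpTo⁻ zero h = 0 , z≤n , ==⇒≡ h
  onPathUpTo⁻ (suc K) {y} h with Equivalence.to T-∨ h
  ... | inj₁ h′ = let t , t≤K , eq = onPathUpTo⁻ K h′ in t , m≤n⇒m≤1+n t≤K , eq
  ... | inj₂ h′ = suc K , ≤-refl , ==⇒≡ h′

  onPathUpTo⁺ : ∀ K {t} → t ≤ K → T (onPathUpTo P d K (x t))
  onPathUpTo⁺ zero z≤n = ==-refl d
  onPathUpTo⁺ (suc K) t≤1+K with m≤n⇒m<n∨m≡n t≤1+K
  ... | inj₁ t<1+K = ∨-introˡ (onPathUpTo⁺ K (≤-pred t<1+K))
  ... | inj₂ refl = ∨-introʳ {onPathUpTo P d K (x (suc K))} (==-refl (x (suc K)))

  OnPath-x : ∀ {t} → t ≤ s → OnPath (x t)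
  OnPath-x = onPathUpTo⁺ s

  OnPath-cases : ∀ {y} → OnPath y → y ≡ d ⊎ ∃ λ t → t < s × y ≡ x (suc t)
  OnPath-cases h with onPathUpTo⁻ s h
  ... | zero , _ , eq = inj₁ eq
  ... | suc t , t<s , eq = inj₂ (t , t<s , eq)

  top : Fin N
  top = if nonRoot P a then par P a else d

  top-nonRoot : T (nonRoot P a) → top ≡ par P a
  top-nonRoot = if-T

  top-root : ¬ T (nonRoot P a) → top ≡ d
  top-root = if-¬T

  private
    parQ : ∀ y → par Q y ≡ reversedParent P d s y
    parQ = lookup∘tabulate _

  parQ-start : par Q d ≡ top
  parQ-start = trans (parQ d) (if-T (==-refl d))

  parQ-x : ∀ {t} → t < s → par Q (x (suc t)) ≡ x t
  parQ-x {t} t<s = trans (parQ (x (suc t))) (trans (if-¬T {b = x (suc t) == d} (x-distinct z<s t<s ∘ sym ∘ ==⇒≡)) (cong (maybe′ x _) first))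
    where
    first : findFirst (λ u → x (suc t) == x (suc u)) s ≡ just t
    first = findFirst-least⇒just _ s (==-refl (x (suc t))) t<s λ u u<t h → x-distinct (s≤s u<t) t<s (sym (==⇒≡ h))

  parQ-off : ∀ {y} → ¬ OnPath y → par Q y ≡ par P y
  parQ-off {y} y-off = trans (parQ y) (trans (if-¬T (y≢x z≤n ∘ ==⇒≡)) (cong (maybe′ x _) none))
    where
    y≢x : ∀ {t} → t ≤ s → y ≢ x t
    y≢x t≤s refl = y-off (OnPath-x t≤s)
    none : findFirst (λ t → y == x (suc t)) s ≡ nothing
    none = findFirst-none _ s λ t t<s → y≢x t<s ∘ ==⇒≡

  iterQ-x : ∀ k t → k + t ≤ s → iter Q k (x (k + t)) ≡ x t
  iterQ-x zero t _ = refl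
  iterQ-x (suc k) t k+t<s =
    trans (iter-suc Q k _) (trans (cong (iter Q k) (parQ-x k+t<s)) (iterQ-x k t (<⇒≤ k+t<s)))

  AncestorQ-x : ∀ {t u} → t ≤ u → u ≤ s → Ancestor Q (x t) (x u)
  AncestorQ-x {t} {u} t≤u u≤s = u ∸ t , subst (λ w → iter Q (u ∸ t) (x w) ≡ x t) (m∸n+n≡m t≤u)
    (iterQ-x (u ∸ t) t (subst (_≤ s) (sym (m∸n+n≡m t≤u)) u≤s))

  iterQ-a : ∀ {t} → t ≤ s → iter Q t a ≡ x (s ∸ t)
  iterQ-a {t} t≤s = subst (λ w → iter Q t (x w) ≡ x (s ∸ t)) (m+[n∸m]≡n t≤s) (iterQ-x t (s ∸ t) (≤-reflexive (m+[n∸m]≡n t≤s)))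

  ¬Ancestor-a-par-a : T (nonRoot P a) → ¬ Ancestor P a (par P a)
  ¬Ancestor-a-par-a a-nonRoot above = nonRoot⇒par≢ a-nonRoot (sym (Ancestor-antisym above (Ancestor-par P a)))

  above-path-off : T (nonRoot P a) → ∀ {w} → Ancestor P w (par P a) → ¬ OnPath w
  above-path-off a-nonRoot above on with onPathUpTo⁻ s on
  ... | v , v≤s , refl = ¬Ancestor-a-par-a a-nonRoot (Ancestor-trans P (x-Ancestor v≤s) above)

  iterQ-above : T (nonRoot P a) → ∀ j → iter Q j (par P a) ≡ iter P j (par P a)
  iterQ-above a-nonRoot zero = refl
  iterQ-above a-nonRoot (suc j) =
    trans (cong (par Q) (iterQ-above a-nonRoot j)) (parQ-off (above-path-off a-nonRoot (j , refl)))

  top-Ancestor-d : Ancestor P top d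
  top-Ancestor-d with T? (nonRoot P a)
  ... | yes a-nonRoot = subst (λ w → Ancestor P w d) (sym (top-nonRoot a-nonRoot)) (x-Ancestor {suc s} z≤n)
  ... | no a-root = subst (λ w → Ancestor P w d) (sym (top-root a-root)) (Ancestor-refl P d)

  Ancestor-a-top⇒top≡d : Ancestor P a top → top ≡ d
  Ancestor-a-top⇒top≡d above with T? (nonRoot P a)
  ... | yes a-nonRoot = ⊥-elim (¬Ancestor-a-par-a a-nonRoot (subst (Ancestor P a) (top-nonRoot a-nonRoot) above))
  ... | no a-root = top-root a-root

  AncestorQ-above : ∀ {z} → ¬ OnPath z → Ancestor P z (par P a) → Ancestor Q z d
  AncestorQ-above {z} z-off (k , eq) with T? (nonRoot P a)
  ... | yes a-nonRoot = Ancestor-trans Q (k , trans (cong (iter Q k) (top-nonRoot a-nonRoot)) (trans (iterQ-above a-nonRoot k) eq)) (1 , parQ-start)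
  ... | no a-root = ⊥-elim (z-off (subst OnPath (sym z≡a) (OnPath-x ≤-refl)))
    where
    a≡root : a ≡ root
    a≡root = ¬nonRoot⇒≡root a-root
    z≡a : z ≡ a
    z≡a = trans (Ancestor-of-root (k , trans (cong (iter P k) (sym (trans (cong (par P) a≡root) par-root))) eq)) (sym a≡root)

  AncestorQ-off⁺ : ∀ {z y} → ¬ OnPath z → Ancestor P z y → Ancestor Q z y
  AncestorQ-off⁺ {z} z-off (j , eq) = go j eq
    where
    go : ∀ j {y} → iter P j y ≡ z → Ancestor Q z y
    go j {y} eq with T? (onPath y)
    go zero refl | no y-off = Ancestor-refl Q z
    go (suc j) {y} eq | no y-off =
      Ancestor-via-par Q (subst (Ancestor Q z) (sym (parQ-off y-off)) (go j (trans (sym (iter-suc P j y)) eq)))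
    ... | yes y-on with onPathUpTo⁻ s y-on
    ...   | u , u≤s , refl with Ancestor-of-x {t = u} (j , eq)
    ...     | inj₁ (v , _ , v≤s , refl) = ⊥-elim (z-off (OnPath-x v≤s))
    ...     | inj₂ above = Ancestor-trans Q (AncestorQ-above z-off above) (AncestorQ-x z≤n u≤s)

  AncestorQ-off⁻ : ∀ {z y} → ¬ OnPath z → Ancestor Q z y → Ancestor P z y
  AncestorQ-off⁻ {z} z-off = Ancestor-ind Q (Ancestor P z) (Ancestor-refl P z) step
    where
    step : ∀ y → Ancestor P z (par Q y) → Ancestor P z y
    step y above with T? (onPath y)
    ... | no y-off = Ancestor-via-par P (subst (Ancestor P z) (parQ-off y-off) above)
    ... | yes y-on with OnPath-cases y-on
    ...   | inj₁ refl = Ancestor-trans P (subst (Ancestor P z) parQ-start above) top-Ancestor-d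
    ...   | inj₂ (t , t<s , refl) with Ancestor-of-x {t = t} (subst (Ancestor P z) (parQ-x t<s) above)
    ...     | inj₁ (v , _ , v≤s , refl) = ⊥-elim (z-off (OnPath-x v≤s))
    ...     | inj₂ above-a = Ancestor-trans P above-a (x-Ancestor {suc s} (s≤s (<⇒≤ t<s)))

  AncestorQ-start⁺ : ∀ {y} → Ancestor P a y → Ancestor Q d y
  AncestorQ-start⁺ = Ancestor-ind P (Ancestor Q d) (AncestorQ-x z≤n ≤-refl) step
    where
    step : ∀ y → Ancestor Q d (par P y) → Ancestor Q d y
    step y above with T? (onPath y)
    ... | no y-off = Ancestor-via-par Q (subst (Ancestor Q d) (sym (parQ-off y-off)) above)
    ... | yes y-on with onPathUpTo⁻ s y-on
    ...   | u , u≤s , refl = AncestorQ-x z≤n u≤s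

  AncestorQ-start⁻ : ∀ {y} → Ancestor Q d y → Ancestor P a y
  AncestorQ-start⁻ = Ancestor-ind Q (Ancestor P a) (s , refl) step
    where
    step : ∀ y → Ancestor P a (par Q y) → Ancestor P a y
    step y above with T? (onPath y)
    ... | no y-off = Ancestor-via-par P (subst (Ancestor P a) (parQ-off y-off) above)
    ... | yes y-on with OnPath-cases y-on
    ...   | inj₁ refl = s , refl
    ...   | inj₂ (t , t<s , refl) = x-Ancestor t<s

  AncestorQ-x⁺ : ∀ {t y} → t < s → Ancestor P a y → ¬ Ancestor P (x t) y → Ancestor Q (x (suc t)) y
  AncestorQ-x⁺ {t} t<s = Ancestor-ind P Ψ (λ _ → AncestorQ-x t<s ≤-refl) step
    where
    Ψ : Fin N → Set
    Ψ y = ¬ Ancestor P (x t) y → Ancestor Q (x (suc t)) y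
    step : ∀ y → Ψ (par P y) → Ψ y
    step y above ¬below-xt with T? (onPath y)
    ... | no y-off = Ancestor-via-par Q (subst (Ancestor Q _) (sym (parQ-off y-off)) (above (¬below-xt ∘ Ancestor-via-par P)))
    ... | yes y-on with onPathUpTo⁻ s y-on
    ...   | u , u≤s , refl = AncestorQ-x (≰⇒> (¬below-xt ∘ x-Ancestor {t} {u})) u≤s

  AncestorQ-x⁻ : ∀ {t y} → t < s → Ancestor Q (x (suc t)) y → Ancestor P a y × ¬ Ancestor P (x t) y
  AncestorQ-x⁻ {t} t<s = Ancestor-ind Q Ψ (x-Ancestor t<s , λ above → 1+n≰n (x-Ancestor⁻ (<⇒≤ t<s) t<s above)) step
    where
    Ψ : Fin N → Set
    Ψ y = Ancestor P a y × ¬ Ancestor P (x t) y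
    step : ∀ y → Ψ (par Q y) → Ψ y
    step y (below-a , ¬below-xt) with T? (onPath y)
    ... | no y-off = Ancestor-via-par P (subst (Ancestor P a) (parQ-off y-off) below-a)
                   , λ above → ¬below-xt (subst (Ancestor P (x t)) (sym (parQ-off y-off))
                       (Ancestor-strict⇒par above λ { refl → y-off (OnPath-x (<⇒≤ t<s)) }))
    ... | yes y-on with OnPath-cases y-on
    ...   | inj₁ refl = subst Ψ (trans parQ-start (Ancestor-a-top⇒top≡d (subst (Ancestor P a) parQ-start below-a))) (below-a , ¬below-xt)
    ...   | inj₂ (u , u<s , refl) = x-Ancestor u<s , λ above → ¬below-xt (subst (Ancestor P (x t)) (sym (parQ-x u<s))
                                      (x-Ancestor (≤-trans (n≤1+n u) (x-Ancestor⁻ (<⇒≤ t<s) u<s above))))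

  root-off : T (nonRoot P a) → ¬ OnPath root
  root-off a-nonRoot on with onPathUpTo⁻ s on
  ... | v , v≤s , eq with m≤n⇒m<n∨m≡n v≤s
  ...   | inj₁ v<s = nonRoot⇒≢root (below-root v v<s) (sym eq)
  ...   | inj₂ refl = nonRoot⇒≢root a-nonRoot (sym eq)

  Q-isTree : T (isTree Q)
  Q-isTree with T? (nonRoot P a)
  ... | yes a-nonRoot = isTree-intro Q root (trans (parQ-off (root-off a-nonRoot)) par-root)
                          λ y → AncestorQ-off⁺ (root-off a-nonRoot) (Ancestor-root y)
  ... | no a-root = isTree-intro Q d (trans parQ-start (top-root a-root))
                      λ y → AncestorQ-start⁺ (subst (λ w → Ancestor P w y) (sym (¬nonRoot⇒≡root a-root)) (Ancestor-root y))

  module Q-tree = RootedTree Q Q-isTree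

  descQ-off : ∀ {z} → ¬ OnPath z → ∀ y → desc Q z y ≡ desc P z y
  descQ-off {z} z-off y = T-ext (λ h → Ancestor⇒desc (AncestorQ-off⁻ z-off (Q-tree.desc⇒Ancestor {z} {y} h)))
                                (λ h → Q-tree.Ancestor⇒desc (AncestorQ-off⁺ z-off (desc⇒Ancestor {z} {y} h)))

  descQ-start : ∀ y → desc Q d y ≡ desc P a y
  descQ-start y = T-ext (λ h → Ancestor⇒desc (AncestorQ-start⁻ (Q-tree.desc⇒Ancestor {d} {y} h)))
                        (λ h → Q-tree.Ancestor⇒desc (AncestorQ-start⁺ (desc⇒Ancestor {a} {y} h)))

  descQ-x : ∀ {t} → t < s → ∀ y → desc Q (x (suc t)) y ≡ (desc P a y ∧ not (desc P (x t) y))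
  descQ-x {t} t<s y = T-ext to from
    where
    to : T (desc Q (x (suc t)) y) → T (desc P a y ∧ not (desc P (x t) y))
    to h = let below-a , ¬below-xt = AncestorQ-x⁻ t<s (Q-tree.desc⇒Ancestor {x (suc t)} {y} h)
           in ∧-intro (Ancestor⇒desc below-a) (not-intro λ h′ → ¬below-xt (desc⇒Ancestor {x t} {y} h′))
    from : T (desc P a y ∧ not (desc P (x t) y)) → T (desc Q (x (suc t)) y)
    from h = Q-tree.Ancestor⇒desc (AncestorQ-x⁺ t<s (desc⇒Ancestor {a} {y} (∧-elimˡ h))
               λ above → not-elim (∧-elimʳ {desc P a y} h) (Ancestor⇒desc above))

  nonRootQ-off : ∀ {y} → ¬ OnPath y → nonRoot Q y ≡ nonRoot P y
  nonRootQ-off {y} y-off = cong (λ w → not (w == y)) (parQ-off y-off)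

  nonRootQ-x : ∀ {t} → t < s → T (nonRoot Q (x (suc t)))
  nonRootQ-x t<s = not-intro λ h → x-distinct ≤-refl t<s (trans (sym (parQ-x t<s)) (==⇒≡ h))

  nonRootQ-start : nonRoot Q d ≡ nonRoot P a
  nonRootQ-start with T? (nonRoot P a)
  ... | yes a-nonRoot = trans (T⇒≡true (not-intro λ h → ¬Ancestor-a-par-a a-nonRoot (subst (Ancestor P a) (d≡par-a h) (s , refl))))
                              (sym (T⇒≡true a-nonRoot))
    where
    d≡par-a : T (par Q d == d) → d ≡ par P a
    d≡par-a h = trans (sym (==⇒≡ h)) (trans parQ-start (top-nonRoot a-nonRoot))
  ... | no a-root = trans (¬T⇒≡false λ h → not-elim h (≡⇒== (trans parQ-start (top-root a-root)))) (sym (¬T⇒≡false a-root))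

  βQ-off : ∀ {z} → ¬ OnPath z → β Q z ≡ β P z
  βQ-off z-off = minLabel-cong Q P (descQ-off z-off)

  βQ-start : β Q d ≡ β P a
  βQ-start = minLabel-cong Q P descQ-start

  properQ-off : ∀ {y} → ¬ OnPath y → proper Q y ≡ proper P y
  properQ-off y-off = cong₂ (λ p b → toℕ p <ᵇ b) (parQ-off y-off) (βQ-off y-off)

  properQ-x : ∀ {t} → t < s → proper Q (x (suc t)) ≡ (toℕ (x t) <ᵇ minLabel P (λ y → desc P a y ∧ not (desc P (x t) y)))
  properQ-x t<s = cong₂ (λ p b → toℕ p <ᵇ b) (parQ-x t<s) (minLabel-cong Q P (descQ-x t<s))

  -- Q's edge above d is P's edge above a: same parent and, by descQ-start, the same subtree below.
  edgeQ-start : (h : Bool → Bool) → (nonRoot Q d ∧ h (proper Q d)) ≡ (nonRoot P a ∧ h (proper P a))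
  edgeQ-start h with T? (nonRoot P a)
  ... | yes a-nonRoot = cong₂ _∧_ nonRootQ-start (cong h (cong₂ (λ p b → toℕ p <ᵇ b) (trans parQ-start (top-nonRoot a-nonRoot)) βQ-start))
  ... | no a-root rewrite nonRootQ-start | ¬T⇒≡false a-root = refl

  count-onPathUpTo : ∀ (g : Fin N → Bool) K → K ≤ s → count (λ y → g y ∧ onPathUpTo P d K y) ≡ sumUpTo (indicator ∘ g ∘ x) K
  count-onPathUpTo g zero _ = count-∧-== g d
  count-onPathUpTo g (suc K) 1+K≤s =
    trans (count-+ _ (λ y → g y ∧ onPathUpTo P d K y) (λ y → g y ∧ (y == x (suc K))) split) (cong₂ _+_ (count-onPathUpTo g K (<⇒≤ 1+K≤s)) (count-∧-== g (x (suc K))))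
    where
    split : ∀ y → indicator (g y ∧ onPathUpTo P d (suc K) y) ≡ indicator (g y ∧ onPathUpTo P d K y) + indicator (g y ∧ (y == x (suc K)))
    split y with T? (onPathUpTo P d K y)
    ... | no off rewrite ¬T⇒≡false off | ∧-zeroʳ (g y) = refl
    ... | yes on with onPathUpTo⁻ K on
    ...   | t , t≤K , refl rewrite T⇒≡true on | ¬T⇒≡false (x-distinct (s≤s t≤K) 1+K≤s ∘ ==⇒≡) | ∧-zeroʳ (g (x t)) = sym (+-identityʳ _)

  count-along-path : ∀ (g : Fin N → Bool) → count g ≡ sumUpTo (indicator ∘ g ∘ x) s + count (λ y → g y ∧ not (onPath y))
  count-along-path g = trans (count-split g onPath) (cong (_+ count (λ y → g y ∧ not (onPath y))) (count-onPathUpTo g s ≤-refl))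

  -- Both path sums are moved across so that no subtraction occurs.
  count-reversal : ∀ (gP gQ : Fin N → Bool) → (∀ {y} → ¬ OnPath y → gQ y ≡ gP y) →
    count gQ + sumUpTo (indicator ∘ gP ∘ x) s ≡ count gP + sumUpTo (indicator ∘ gQ ∘ x) s
  count-reversal gP gQ agree-off = begin
    count gQ + pathP           ≡⟨ cong (_+ pathP) (count-along-path gQ) ⟩
    (pathQ + offQ) + pathP     ≡⟨ cong (λ o → (pathQ + o) + pathP) off-equal ⟩
    (pathQ + offP) + pathP     ≡⟨ xy∙z≈zy∙x pathQ offP pathP ⟩
    (pathP + offP) + pathQ     ≡⟨ cong (_+ pathQ) (count-along-path gP) ⟨
    count gP + pathQ           ∎
    where
    pathP pathQ offQ offP : ℕ
    pathP = sumUpTo (indicator ∘ gP ∘ x) s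
    pathQ = sumUpTo (indicator ∘ gQ ∘ x) s
    offQ = count (λ y → gQ y ∧ not (onPath y))
    offP = count (λ y → gP y ∧ not (onPath y))
    agree : ∀ y → Dec (OnPath y) → (gQ y ∧ not (onPath y)) ≡ (gP y ∧ not (onPath y))
    agree y (yes on) rewrite T⇒≡true on = trans (∧-zeroʳ (gQ y)) (sym (∧-zeroʳ (gP y)))
    agree y (no off) rewrite agree-off off = refl
    off-equal : offQ ≡ offP
    off-equal = count-cong λ y → agree y (T? (onPath y))

  childlessQ : ∀ {z} → d ≢ z → (∀ y → ¬ T (isChild P z y)) → ∀ y → ¬ T (isChild Q z y)
  childlessQ {z} d≢z childless y with T? (onPath y)
  ... | no y-off = subst (λ b → ¬ T b) (sym (cong₂ _∧_ (nonRootQ-off y-off) (cong (_== z) (parQ-off y-off)))) (childless y)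
  ... | yes y-on with OnPath-cases y-on
  ...   | inj₁ refl = λ h → edge-above-a (subst T nonRootQ-start (∧-elimˡ h)) (==⇒≡ (∧-elimʳ {nonRoot Q d} h))
    where
    edge-above-a : T (nonRoot P a) → par Q d ≡ z → ⊥
    edge-above-a a-nonRoot eq = childless a (∧-intro a-nonRoot (≡⇒== (trans (sym (trans parQ-start (top-nonRoot a-nonRoot))) eq)))
  ...   | inj₂ (zero , 0<s , refl) = λ h → d≢z (trans (sym (parQ-x 0<s)) (==⇒≡ (∧-elimʳ {nonRoot Q (x 1)} h)))
  ...   | inj₂ (suc t , t<s , refl) = λ h → childless (x t)
          (∧-intro (below-root t (<-trans (n<1+n t) t<s)) (≡⇒== (trans (sym (parQ-x t<s)) (==⇒≡ (∧-elimʳ {nonRoot Q (x (suc (suc t)))} h)))))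

reversePath-involutive : ∀ {n} (P : Parents (suc n)) → T (isTree P) → ∀ d s → (∀ t → t < s → T (nonRoot P (iter P t d))) →
  reversePath (reversePath P d s) (iter P s d) s ≡ P
reversePath-involutive P tree d s below-root =
  trans (tabulate-cong λ y → trans (sym (lookup∘tabulate (reversedParent Q a s) y)) (reversed-twice y)) (tabulate∘lookup P)
  where
  open PathReversal P tree d s below-root
  open RootedTree P tree

  s∸t≡1+s∸1+t : ∀ {t} → t < s → s ∸ t ≡ suc (s ∸ suc t)
  s∸t≡1+s∸1+t = +-∸-assoc 1

  below-rootQ : ∀ t → t < s → T (nonRoot Q (iter Q t a))
  below-rootQ t t<s = subst (T ∘ nonRoot Q) (sym (trans (iterQ-a (<⇒≤ t<s)) (cong x (s∸t≡1+s∸1+t t<s))))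
                        (nonRootQ-x (subst (_≤ s) (s∸t≡1+s∸1+t t<s) (m∸n≤m s t)))

  module R = PathReversal Q Q-isTree a s below-rootQ

  R-x : ∀ {t} → t ≤ s → R.x t ≡ x (s ∸ t)
  R-x = iterQ-a

  R-a : R.a ≡ d
  R-a = trans (R-x ≤-refl) (cong x (n∸n≡0 s))

  OnPath⇒R-OnPath : ∀ {y} → OnPath y → R.OnPath y
  OnPath⇒R-OnPath on with onPathUpTo⁻ s on
  ... | t , t≤s , refl = subst R.OnPath (trans (R-x (m∸n≤m s t)) (cong x (m∸[m∸n]≡n t≤s))) (R.OnPath-x (m∸n≤m s t))

  R-top≡par-a : R.top ≡ par P a
  R-top≡par-a with T? (nonRoot P a)
  ... | yes a-nonRoot = trans (R.top-nonRoot (subst (T ∘ nonRoot Q) (sym R-a) (subst T (sym nonRootQ-start) a-nonRoot)))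
                              (trans (cong (par Q) R-a) (trans parQ-start (top-nonRoot a-nonRoot)))
  ... | no a-root = trans (R.top-root λ h → a-root (subst T nonRootQ-start (subst (T ∘ nonRoot Q) R-a h)))
                          (sym (trans (cong (par P) (¬nonRoot⇒≡root a-root)) (trans par-root (sym (¬nonRoot⇒≡root a-root)))))

  reversed-twice : ∀ y → par R.Q y ≡ par P y
  reversed-twice y with T? (R.onPath y)
  ... | no y-off = trans (R.parQ-off y-off) (parQ-off (y-off ∘ OnPath⇒R-OnPath))
  ... | yes y-on with R.OnPath-cases y-on
  ...   | inj₁ refl = trans R.parQ-start R-top≡par-a
  ...   | inj₂ (t , t<s , refl) =
          trans (R.parQ-x t<s) (trans (R-x (<⇒≤ t<s)) (trans (cong x (s∸t≡1+s∸1+t t<s)) (cong (par P) (sym (R-x t<s)))))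

-- The lower critical node

module _ {n : ℕ} (P : Parents (suc n)) (v : Fin (suc n)) where
  open Critical P v

  lam-βnode : ∀ {b} → βnode ≡ just b → lam ≡ head? P (filterᵇ (isLambda b) (allFin (suc n)))
  lam-βnode eq with βnode
  lam-βnode refl | just _ = refl

  lambdaGt1-intro : ∀ {u} → lam ≡ just u → u ≢ fzero → T (lambdaGt1 P v)
  lambdaGt1-intro {u} eq u≢0 with lam
  lambdaGt1-intro {fzero} refl u≢0 | just _ = u≢0 refl
  lambdaGt1-intro {fsuc _} refl u≢0 | just _ = _

  lambdaGt1-elim : T (lambdaGt1 P v) → ∃ λ u → lam ≡ just u × u ≢ fzero
  lambdaGt1-elim h with lam
  ... | just (fsuc u) = fsuc u , refl , λ ()

module LowerCriticalNode {n : ℕ} (P : Parents (suc n)) (tree : T (isTree P)) (v : Fin (suc n)) where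
  open RootedTree P tree
  open Critical P v

  private
    N : ℕ
    N = suc n

  βnode-least : ∀ {b} → βnode ≡ just b → T (desc P v b) × (∀ y → T (desc P v y) → toℕ b ≤ toℕ y)
  βnode-least = head?-filterᵇ-least P (desc P v)

  βnode-∃ : ∃ λ b → βnode ≡ just b
  βnode-∃ = head?-filterᵇ-∃ P (desc P v) {v} (Ancestor⇒desc (Ancestor-refl P v))

  record OnCriticalPath (b u : Fin N) : Set where
    field
      below-v : T (desc P v u)
      ≢v : u ≢ v
      above-b : T (desc P u b)

  onPath⁺ : ∀ {b u} → OnCriticalPath b u → T (onPath b u)
  onPath⁺ p = ∧-intro below-v (∧-intro (not-intro (≢v ∘ ==⇒≡)) above-b)
    where open OnCriticalPath p

  onPath⁻ : ∀ {b u} → T (onPath b u) → OnCriticalPath b u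
  onPath⁻ {b} {u} h = record
    { below-v = ∧-elimˡ h
    ; ≢v = not-elim (∧-elimˡ rest) ∘ ≡⇒==
    ; above-b = ∧-elimʳ {not (u == v)} rest
    }
    where
    rest : T (not (u == v) ∧ desc P u b)
    rest = ∧-elimʳ {desc P v u} h

  critical⁺ : ∀ {u} → (∀ y → T (desc P v y) → ¬ T (desc P u y) → toℕ u < toℕ y) → T (critical u)
  critical⁺ {u} below = <ᵇ-minLabel⁺ P _ (toℕ<n u) λ y h → below y (∧-elimˡ h) (not-elim (∧-elimʳ {desc P v y} h))

  critical⁻ : ∀ {u} → T (critical u) → ∀ {y} → T (desc P v y) → ¬ T (desc P u y) → toℕ u < toℕ y
  critical⁻ {u} h {y} below-v ¬below-u = <ᵇ-minLabel⁻ P (λ y → desc P v y ∧ not (desc P u y)) h (∧-intro below-v (not-intro ¬below-u))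

  ¬critical⇒∃ : ∀ {u} → ¬ T (critical u) → ∃ λ y → T (desc P v y) × ¬ T (desc P u y) × toℕ y ≤ toℕ u
  ¬critical⇒∃ {u} h with ¬<ᵇ-minLabel⇒∃ P _ (toℕ<n u) h
  ... | y , below , y≤u = y , ∧-elimˡ below , not-elim (∧-elimʳ {desc P v y} below) , y≤u

  record IsLowerCritical (b u : Fin N) : Set where
    field
      on-path : OnCriticalPath b u
      is-critical : T (critical u)
      topmost : ∀ w → OnCriticalPath b w → w ≢ u → T (desc P w u) → ¬ T (critical w)

  private
    higher-critical : Fin N → Fin N → Fin N → Bool
    higher-critical b u w = onPath b w ∧ not (w == u) ∧ desc P w u ∧ critical w

    higher-critical⁺ : ∀ {b u w} → OnCriticalPath b w → w ≢ u → T (desc P w u) → T (critical w) → T (higher-critical b u w)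
    higher-critical⁺ on w≢u w-above-u w-critical =
      ∧-intro (onPath⁺ on) (∧-intro (not-intro (w≢u ∘ ==⇒≡)) (∧-intro w-above-u w-critical))

    higher-critical⁻ : ∀ {b u w} → T (higher-critical b u w) → OnCriticalPath b w × w ≢ u × T (desc P w u) × T (critical w)
    higher-critical⁻ {b} {u} {w} h =
      onPath⁻ {b} {w} (∧-elimˡ h) , not-elim (∧-elimˡ h₁) ∘ ≡⇒== , ∧-elimˡ h₂ , ∧-elimʳ {desc P w u} h₂
      where
      h₁ : T (not (w == u) ∧ desc P w u ∧ critical w)
      h₁ = ∧-elimʳ {onPath b w} h
      h₂ : T (desc P w u ∧ critical w)
      h₂ = ∧-elimʳ {not (w == u)} h₁

    no-higher-critical : ∀ {b u} → (∀ w → OnCriticalPath b w → w ≢ u → T (desc P w u) → ¬ T (critical w)) →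
      ¬ T (any (higher-critical b u) (allFin N))
    no-higher-critical {b} {u} topmost h with Any-tabulate⁻ {f = id} (any⁻ (higher-critical b u) (allFin N) h)
    ... | w , hw = let on , w≢u , w-above-u , w-critical = higher-critical⁻ {b} {u} {w} hw in topmost w on w≢u w-above-u w-critical

  isLambda⁺ : ∀ {b u} → IsLowerCritical b u → T (isLambda b u)
  isLambda⁺ λu = ∧-intro (onPath⁺ on-path) (∧-intro is-critical (not-intro (no-higher-critical topmost)))
    where open IsLowerCritical λu

  isLambda⁻ : ∀ {b u} → T (isLambda b u) → IsLowerCritical b u
  isLambda⁻ {b} {u} h = record
    { on-path = onPath⁻ {b} {u} (∧-elimˡ h)
    ; is-critical = ∧-elimˡ rest
    ; topmost = λ w on w≢u w-above-u w-critical → not-elim (∧-elimʳ {critical u} rest)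
        (any⁺ _ (Any-tabulate⁺ {f = id} w (higher-critical⁺ on w≢u w-above-u w-critical)))
    }
    where
    rest : T (critical u ∧ not (any (higher-critical b u) (allFin N)))
    rest = ∧-elimʳ {onPath b u} h

  isLambda-unique : ∀ {b u u′} → T (isLambda b u) → T (isLambda b u′) → u ≡ u′
  isLambda-unique {b} {u} {u′} h h′ with u ≟ u′
  ... | yes u≡u′ = u≡u′
  ... | no u≢u′ with Ancestor-linear (desc⇒Ancestor {u} {b} (above-b on-u)) (desc⇒Ancestor {u′} {b} (above-b on-u′))
    where
    open OnCriticalPath
    on-u : OnCriticalPath b u
    on-u = IsLowerCritical.on-path (isLambda⁻ {b} {u} h)
    on-u′ : OnCriticalPath b u′
    on-u′ = IsLowerCritical.on-path (isLambda⁻ {b} {u′} h′)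
  ...   | inj₁ u′-above-u = ⊥-elim (topmost u′ on-path (u≢u′ ∘ sym) (Ancestor⇒desc u′-above-u) is-critical)
    where
    open IsLowerCritical (isLambda⁻ {b} {u} h) using (topmost)
    open IsLowerCritical (isLambda⁻ {b} {u′} h′) using (on-path; is-critical)
  ...   | inj₂ u-above-u′ = ⊥-elim (topmost u on-path u≢u′ (Ancestor⇒desc u-above-u′) is-critical)
    where
    open IsLowerCritical (isLambda⁻ {b} {u} h) using (on-path; is-critical)
    open IsLowerCritical (isLambda⁻ {b} {u′} h′) using (topmost)

  lam-just : ∀ {b u} → βnode ≡ just b → T (isLambda b u) → lam ≡ just u
  lam-just {b} {u} βb λu = trans (lam-βnode P v βb) (head?-filterᵇ-unique P (isLambda b) λu λ y λy → isLambda-unique {b} {y} {u} λy λu)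

  lam-just⁻ : ∀ {b u} → βnode ≡ just b → lam ≡ just u → T (isLambda b u)
  lam-just⁻ {b} βb eq = proj₁ (head?-filterᵇ-least P (isLambda b) (trans (sym (lam-βnode P v βb)) eq))

  -- Induction on the distance from u up to v: a higher critical node on the path is strictly closer to v.
  private
    topmost-critical : ∀ {b} k u → iter P k u ≡ v → OnCriticalPath b u → T (critical u) → ∃ λ u′ → T (isLambda b u′)
    topmost-critical {b} = <-rec Ψ step
      where
      Ψ : ℕ → Set
      Ψ k = ∀ u → iter P k u ≡ v → OnCriticalPath b u → T (critical u) → ∃ λ u′ → T (isLambda b u′)
      step : ∀ k → (∀ {k′} → k′ < k → Ψ k′) → Ψ k
      step k rec u uk≡v on-u u-critical with T? (any (higher-critical b u) (allFin N))
      ... | no none = u , isLambda⁺ record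
            { on-path = on-u ; is-critical = u-critical
            ; topmost = λ w on w≢u w-above-u w-critical → none
                (any⁺ _ (Any-tabulate⁺ {f = id} w (higher-critical⁺ on w≢u w-above-u w-critical))) }
      ... | yes some with Any-tabulate⁻ {f = id} (any⁻ (higher-critical b u) (allFin N) some)
      ...   | w , hw with higher-critical⁻ {b} {u} {w} hw
      ...     | on-w , w≢u , w-above-u , w-critical with desc⇒Ancestor {w} {u} w-above-u
      ...       | zero , refl = ⊥-elim (w≢u refl)
      ...       | m@(suc _) , um≡w = rec (∸-monoʳ-< z<s (<⇒≤ m<k)) w (trans (cong (iter P (k ∸ m)) (sym um≡w)) (trans (iter-∸ P u (<⇒≤ m<k)) uk≡v)) on-w w-critical
        where
        m<k : m < k
        m<k = ≰⇒> λ k≤m → OnCriticalPath.≢v on-w (Ancestor-antisym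
                (m ∸ k , trans (cong (iter P (m ∸ k)) (sym uk≡v)) (trans (iter-∸ P u k≤m) um≡w))
                (desc⇒Ancestor {v} {w} (OnCriticalPath.below-v on-w)))

  lam-∃ : ∀ {b} → βnode ≡ just b → b ≢ v → ∃ λ u → lam ≡ just u × T (isLambda b u)
  lam-∃ {b} βb b≢v with desc⇒Ancestor {v} {b} (proj₁ (βnode-least βb))
  ... | D , bD≡v with topmost-critical D b bD≡v on-b b-critical
    where
    on-b : OnCriticalPath b b
    on-b = record { below-v = proj₁ (βnode-least βb) ; ≢v = b≢v ; above-b = Ancestor⇒desc (Ancestor-refl P b) }
    b-critical : T (critical b)
    b-critical = critical⁺ λ y below-v ¬below-b → ≤∧≢⇒< (proj₂ (βnode-least βb) y below-v)
                   λ eq → ¬below-b (subst (T ∘ desc P b) (toℕ-injective eq) (Ancestor⇒desc (Ancestor-refl P b)))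
  ...   | u , λu = u , lam-just βb λu , λu

-- The two maps

-- R n k i m is Σ (Parents (suc n)) (InR n k i m) by definition.
InR : (n k i m : ℕ) → Parents (suc n) → Set
InR n k i m P = T (isTree P)
  × improperCount P ≡ k
  × pathProperCount P (fromℕ n) ≡ i
  × deg P (fromℕ n) ≡ m
  × deg P fzero ≡ 0
  × T (lambdaGt1 P (fromℕ n))

-- The fallback values in forwardTree and backwardTree are never used on trees of R, and the bound
-- in stepsTo only has to exceed every distance in the tree.
firstProperStep : ∀ {n} → Parents (suc n) → Maybe ℕ
firstProperStep {n} P = findFirst (λ t → hasProperEdge P (iter P t (fromℕ n))) (suc n)

forwardTree : ∀ {n} → Parents (suc n) → Parents (suc n)
forwardTree {n} P = maybe′ (λ j → reversePath P (fromℕ n) (suc j)) P (firstProperStep P)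

stepsTo : ∀ {n} → Parents (suc n) → Fin (suc n) → Fin (suc n) → Maybe ℕ
stepsTo {n} S u v = findFirst (λ t → iter S t u == v) (suc (suc n))

backwardTree : ∀ {n} → Parents (suc n) → Parents (suc n)
backwardTree {n} S = maybe′ (λ u → maybe′ (reversePath S u) S (stepsTo S u (fromℕ n))) S (Critical.lam S (fromℕ n))

firstProperStep-∃ : ∀ {n i} (P : Parents (suc n)) → T (isTree P) → 1 ≤ i → pathProperCount P (fromℕ n) ≡ i →
  ∃ λ j → firstProperStep P ≡ just j
firstProperStep-∃ {n} P tree i≥1 pathProper≡i
  with count≢0⇒∃ (isProperOnPathFrom P (fromℕ n)) (λ c≡0 → <⇒≢ i≥1 (sym (trans (sym pathProper≡i) c≡0)))
... | y , h with RootedTree.desc⇒Ancestor P tree {y} {fromℕ n} (∧-elimˡ (∧-elimʳ {nonRoot P y} h))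
...   | t , refl = findFirst-∃ (λ t → hasProperEdge P (iter P t (fromℕ n))) (suc n) proper-edge
                     (RootedTree.nonRoot-iter⇒<N P tree {t} {fromℕ n} (∧-elimˡ h))
  where
  proper-edge : T (hasProperEdge P (iter P t (fromℕ n)))
  proper-edge = ∧-intro (∧-elimˡ h) (∧-elimʳ {desc P (iter P t (fromℕ n)) (fromℕ n)} (∧-elimʳ {nonRoot P (iter P t (fromℕ n))} h))

module Forward {n k i m : ℕ} (i≥1 : 1 ≤ i) (m≥1 : 1 ≤ m) (P : Parents (suc n)) (tree : T (isTree P))
               (improper≡k : improperCount P ≡ k) (pathProper≡i : pathProperCount P (fromℕ n) ≡ i)
               (deg-v≡m : deg P (fromℕ n) ≡ m) (deg-1≡0 : deg P fzero ≡ 0)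
               (j : ℕ) (j-first : firstProperStep P ≡ just j) where

  open RootedTree P tree

  private
    N : ℕ
    N = suc n
    v : Fin N
    v = fromℕ n
    j-least : T (hasProperEdge P (iter P j v)) × j < N × (∀ t → t < j → ¬ T (hasProperEdge P (iter P t v)))
    j-least = findFirst-just⇒least (λ t → hasProperEdge P (iter P t v)) N j-first

  j<N : j < N
  j<N = proj₁ (proj₂ j-least)

  xj-nonRoot : T (nonRoot P (iter P j v))
  xj-nonRoot = ∧-elimˡ (proj₁ j-least)

  below-root : ∀ t → t < suc j → T (nonRoot P (iter P t v))
  below-root t (s≤s t≤j) = ≢root⇒nonRoot λ xt≡root → nonRoot⇒≢root xj-nonRoot
    (trans (sym (iter-∸ P v t≤j)) (trans (cong (iter P (j ∸ t)) xt≡root) (iter-root (j ∸ t))))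

  open PathReversal P tree v (suc j) below-root

  forwardTree≡Q : forwardTree P ≡ Q
  forwardTree≡Q = cong (maybe′ _ P) j-first

  xj-proper : T (proper P (x j))
  xj-proper = ∧-elimʳ {nonRoot P (x j)} (proj₁ j-least)

  improper-below-j : ∀ {t} → t < j → ¬ T (proper P (x t))
  improper-below-j {t} t<j h = proj₂ (proj₂ j-least) t t<j (∧-intro (below-root t (m≤n⇒m≤1+n t<j)) h)

  a<β-xj : toℕ a < β P (x j)
  a<β-xj = <ᵇ⇒< _ _ xj-proper

  β-xj≤x : ∀ {t} → t ≤ j → β P (x j) ≤ toℕ (x t)
  β-xj≤x t≤j = minLabel-≤ P (desc P (x j)) (Ancestor⇒desc (x-Ancestor t≤j))

  a∉T-x : ∀ {t} → t ≤ j → ¬ T (desc P (x t) a)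
  a∉T-x {t} t≤j h = 1+n≰n (≤-trans (x-Ancestor⁻ (m≤n⇒m≤1+n t≤j) ≤-refl (desc⇒Ancestor {x t} {a} h)) t≤j)

  improperQ-x : ∀ {t} → t ≤ j → ¬ T (proper Q (x (suc t)))
  improperQ-x {t} t≤j h = <-irrefl refl (<-trans xt<a (<-≤-trans a<β-xj (β-xj≤x t≤j)))
    where
    xt<a : toℕ (x t) < toℕ a
    xt<a = <ᵇ-minLabel⁻ P (λ y → desc P a y ∧ not (desc P (x t) y)) (subst T (properQ-x (s≤s t≤j)) h)
             (∧-intro (Ancestor⇒desc (Ancestor-refl P a)) (not-intro (a∉T-x t≤j)))

  a≢v : a ≢ v
  a≢v us≡v = 1+n≢0 (x-injective ≤-refl z≤n us≡v)

  improperCountQ : improperCount Q ≡ suc k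
  improperCountQ = +-cancelʳ-≡ (j + e) _ _ (begin
    improperCount Q + (j + e)    ≡⟨ cong (improperCount Q +_) old ⟨
    improperCount Q + oldSum     ≡⟨ count-reversal (isImproper P) (isImproper Q) agree-off ⟩
    improperCount P + newSum     ≡⟨ cong₂ _+_ improper≡k new ⟩
    k + (e + suc j)              ≡⟨ cong (k +_) (trans (+-suc e j) (cong suc (+-comm e j))) ⟩
    k + suc (j + e)              ≡⟨ +-suc k (j + e) ⟩
    suc k + (j + e)              ∎)
    where
    e oldSum newSum : ℕ
    e = indicator (isImproper P a)
    oldSum = sumUpTo (indicator ∘ isImproper P ∘ x) (suc j)
    newSum = sumUpTo (indicator ∘ isImproper Q ∘ x) (suc j)
    agree-off : ∀ {y} → ¬ OnPath y → isImproper Q y ≡ isImproper P y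
    agree-off off = cong₂ _∧_ (nonRootQ-off off) (cong not (properQ-off off))
    old : oldSum ≡ j + e
    old = cong (_+ e) (sumUpTo-ones-then-0 _ j
      (λ t t<j → indicator-true (∧-intro (below-root t (m≤n⇒m≤1+n t<j)) (not-intro (improper-below-j t<j))))
      (indicator-false λ h → not-elim (∧-elimʳ {nonRoot P (x j)} h) xj-proper))
    new : newSum ≡ e + suc j
    new = trans (sumUpTo-shift _ j) (cong₂ _+_ (cong indicator (edgeQ-start not))
      (sumUpTo-ones _ j λ t t≤j → indicator-true (∧-intro (nonRootQ-x (s≤s t≤j)) (not-intro (improperQ-x t≤j)))))

  pathProperCountQ : pathProperCount Q v ≡ i ∸ 1
  pathProperCountQ = +-cancelʳ-≡ (1 + p) _ _ (begin
    pathProperCount Q v + (1 + p)      ≡⟨ cong (pathProperCount Q v +_) old ⟨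
    pathProperCount Q v + oldSum       ≡⟨ count-reversal (isProperOnPathFrom P v) (isProperOnPathFrom Q v) agree-off ⟩
    pathProperCount P v + newSum       ≡⟨ cong₂ _+_ pathProper≡i new ⟩
    i + (p + 0)                        ≡⟨ cong (_+ (p + 0)) (m∸n+n≡m i≥1) ⟨
    (i ∸ 1 + 1) + (p + 0)              ≡⟨ cong ((i ∸ 1 + 1) +_) (+-identityʳ p) ⟩
    (i ∸ 1 + 1) + p                    ≡⟨ +-assoc (i ∸ 1) 1 p ⟩
    i ∸ 1 + (1 + p)                    ∎)
    where
    p oldSum newSum : ℕ
    p = indicator (hasProperEdge P a)
    oldSum = sumUpTo (indicator ∘ isProperOnPathFrom P v ∘ x) (suc j)
    newSum = sumUpTo (indicator ∘ isProperOnPathFrom Q v ∘ x) (suc j)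
    agree-off : ∀ {y} → ¬ OnPath y → isProperOnPathFrom Q v y ≡ isProperOnPathFrom P v y
    agree-off {y} off = cong₂ _∧_ (nonRootQ-off off) (cong₂ _∧_ (descQ-off off v) (properQ-off off))
    a-above-v : T (desc P a v)
    a-above-v = Ancestor⇒desc (x-Ancestor {suc j} {0} z≤n)
    old : oldSum ≡ 1 + p
    old = cong₂ _+_ (sumUpTo-zeros-then-1 _ j
      (λ t t<j → indicator-false λ h → improper-below-j t<j (∧-elimʳ {desc P (x t) v} (∧-elimʳ {nonRoot P (x t)} h)))
      (indicator-true (∧-intro xj-nonRoot (∧-intro (Ancestor⇒desc (x-Ancestor {j} {0} z≤n)) xj-proper))))
      (cong (λ b → indicator (nonRoot P a ∧ (b ∧ proper P a))) (T⇒≡true a-above-v))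
    new : newSum ≡ p + 0
    new = trans (sumUpTo-shift _ j) (cong₂ _+_ start (sumUpTo-zeros _ j λ t t≤j → indicator-false (v∉Q-x t≤j)))
      where
      start : indicator (isProperOnPathFrom Q v v) ≡ p
      start = cong indicator (trans (cong (λ b → nonRoot Q v ∧ (b ∧ proper Q v)) (trans (descQ-start v) (T⇒≡true a-above-v))) (edgeQ-start id))
      v∉Q-x : ∀ {t} → t ≤ j → ¬ T (isProperOnPathFrom Q v (x (suc t)))
      v∉Q-x {t} t≤j h = not-elim (∧-elimʳ {desc P a v} (subst T (descQ-x (s≤s t≤j) v) (∧-elimˡ (∧-elimʳ {nonRoot Q (x (suc t))} h))))
                          (Ancestor⇒desc (x-Ancestor {t} {0} z≤n))

  degQ-v : deg Q v ≡ suc m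
  degQ-v = +-cancelʳ-≡ 0 _ _ (begin
    deg Q v + 0          ≡⟨ cong (deg Q v +_) old ⟨
    deg Q v + oldSum     ≡⟨ count-reversal (isChild P v) (isChild Q v) agree-off ⟩
    deg P v + newSum     ≡⟨ cong₂ _+_ deg-v≡m new ⟩
    m + 1                ≡⟨ +-comm m 1 ⟩
    suc m                ≡⟨ +-identityʳ (suc m) ⟨
    suc m + 0            ∎)
    where
    oldSum newSum : ℕ
    oldSum = sumUpTo (indicator ∘ isChild P v ∘ x) (suc j)
    newSum = sumUpTo (indicator ∘ isChild Q v ∘ x) (suc j)
    agree-off : ∀ {y} → ¬ OnPath y → isChild Q v y ≡ isChild P v y
    agree-off off = cong₂ _∧_ (nonRootQ-off off) (cong (_== v) (parQ-off off))
    par-x≢v : ∀ {t} → 1 ≤ t → t ≤ suc j → par P (x t) ≢ v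
    par-x≢v {t} 1≤t t≤s eq = <⇒≢ 1≤t (sym (x-injective t≤s z≤n (sym (Ancestor-antisym (1 , eq) (x-Ancestor {t} {0} z≤n)))))
    old : oldSum ≡ 0
    old = sumUpTo-zeros _ (suc j) λ where
      zero _ → indicator-false (¬isChild-self P v)
      (suc t) t<s → indicator-false λ h → par-x≢v (s≤s z≤n) t<s (==⇒≡ (∧-elimʳ {nonRoot P (x (suc t))} h))
    new : newSum ≡ 0 + 1
    new = trans (sumUpTo-shift _ j) (cong₂ _+_ (indicator-false (¬isChild-self Q v))
      (sumUpTo-1-then-zeros _ j (indicator-true (∧-intro (nonRootQ-x (s≤s z≤n)) (≡⇒== (parQ-x (s≤s z≤n)))))
        λ t 1≤t t≤j → indicator-false λ h → x-distinct 1≤t (m≤n⇒m≤1+n t≤j)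
          (sym (trans (sym (parQ-x (s≤s t≤j))) (==⇒≡ (∧-elimʳ {nonRoot Q (x (suc t))} h))))))

  childless-1 : ∀ y → ¬ T (isChild P fzero y)
  childless-1 = count≡0⇒¬ (isChild P fzero) deg-1≡0

  v≢1 : v ≢ fzero
  v≢1 v≡1 with count≢0⇒∃ (isChild P v) (λ c≡0 → <⇒≢ m≥1 (sym (trans (sym deg-v≡m) c≡0)))
  ... | y , h = childless-1 y (subst (T ∘ λ w → isChild P w y) v≡1 h)

  degQ-1 : deg Q fzero ≡ 0
  degQ-1 = count-none (isChild Q fzero) (childlessQ v≢1 childless-1)

  a≢1 : a ≢ fzero
  a≢1 a≡1 = childless-1 (x j) (∧-intro xj-nonRoot (≡⇒== a≡1))

  module LQ = LowerCriticalNode Q Q-isTree v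

  a<T-xj : ∀ {y} → T (desc P (x j) y) → toℕ a < toℕ y
  a<T-xj h = <-≤-trans a<β-xj (minLabel-≤ P (desc P (x j)) h)

  -- A path node x₍ₜ₊₁₎ with t < j is not critical: the improper edge above xₜ gives a node
  -- y ∈ T_{xₜ} with y ≤ x₍ₜ₊₁₎, and y lies below v but not below x₍ₜ₊₁₎ in Q.
  a-topmost : ∀ {b′} w → LQ.OnCriticalPath b′ w → w ≢ a → T (desc Q w a) → ¬ T (Critical.critical Q v w)
  a-topmost w on w≢a w-above-a with T? (onPath w)
  ... | no w-off = ⊥-elim (w≢a (Ancestor-antisym (desc⇒Ancestor {w} {a} (subst T (descQ-off w-off a) w-above-a))
                                  (desc⇒Ancestor {a} {w} (subst T (descQ-start w) (LQ.OnCriticalPath.below-v on)))))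
  ... | yes w-on with OnPath-cases w-on
  ...   | inj₁ refl = ⊥-elim (LQ.OnCriticalPath.≢v on refl)
  ...   | inj₂ (t , t<s , refl) with m≤n⇒m<n∨m≡n (≤-pred t<s)
  ...     | inj₂ refl = ⊥-elim (w≢a refl)
  ...     | inj₁ t<j with ¬<ᵇ-minLabel⇒∃ P (desc P (x t)) (toℕ<n (x (suc t))) (improper-below-j t<j)
  ...       | y , y∈T-xt , y≤x = λ w-critical → <-irrefl refl (<-≤-trans (LQ.critical⁻ w-critical y∈Q-v y∉Q-w) y≤x)
    where
    y∈Q-v : T (desc Q v y)
    y∈Q-v = subst T (sym (descQ-start y)) (Ancestor⇒desc (Ancestor-trans P (x-Ancestor {suc j} {t} (m≤n⇒m≤1+n (<⇒≤ t<j))) (desc⇒Ancestor {x t} {y} y∈T-xt)))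
    y∉Q-w : ¬ T (desc Q (x (suc t)) y)
    y∉Q-w h = not-elim (∧-elimʳ {desc P a y} (subst T (descQ-x t<s y) h)) y∈T-xt

  a-lower-critical : ∀ {b′} → Critical.βnode Q v ≡ just b′ → LQ.IsLowerCritical b′ a
  a-lower-critical {b′} βb′ = record
    { on-path = record { below-v = a-below-v ; ≢v = a≢v ; above-b = subst T (sym (descQ-x ≤-refl b′)) (∧-intro b′∈T-a (not-intro b′∉T-xj)) }
    ; is-critical = LQ.critical⁺ λ y y∈T-v y∉T-a → a<T-xj (T-a∖T-xj y (subst T (descQ-start y) y∈T-v) y∉T-a)
    ; topmost = a-topmost
    }
    where
    a-below-v : T (desc Q v a)
    a-below-v = subst T (sym (descQ-start a)) (Ancestor⇒desc (Ancestor-refl P a))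
    b′∈T-a : T (desc P a b′)
    b′∈T-a = subst T (descQ-start b′) (proj₁ (LQ.βnode-least βb′))
    b′∉T-xj : ¬ T (desc P (x j) b′)
    b′∉T-xj h = <-irrefl refl (<-≤-trans (a<T-xj h) (proj₂ (LQ.βnode-least βb′) a a-below-v))
    T-a∖T-xj : ∀ y → T (desc P a y) → ¬ T (desc Q a y) → T (desc P (x j) y)
    T-a∖T-xj y y∈T-a y∉Q-a with T? (desc P (x j) y)
    ... | yes y∈T-xj = y∈T-xj
    ... | no y∉T-xj = ⊥-elim (y∉Q-a (subst T (sym (descQ-x ≤-refl y)) (∧-intro y∈T-a (not-intro y∉T-xj))))

  lamQ : Critical.lam Q v ≡ just a
  lamQ with LQ.βnode-∃
  ... | b′ , βb′ = LQ.lam-just βb′ (LQ.isLambda⁺ (a-lower-critical βb′))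

  stepsQ : stepsTo Q a v ≡ just (suc j)
  stepsQ = findFirst-least⇒just (λ t → iter Q t a == v) (suc N) (≡⇒== (trans (iterQ-a ≤-refl) (cong x (n∸n≡0 (suc j))))) (s≤s j<N)
    λ t t<s h → x-distinct (m<n⇒0<n∸m t<s) (m∸n≤m (suc j) t) (sym (trans (sym (iterQ-a (<⇒≤ t<s))) (==⇒≡ h)))

  backwardTree-Q : backwardTree Q ≡ P
  backwardTree-Q = trans (cong (maybe′ _ Q) lamQ) (trans (cong (maybe′ (reversePath Q a) Q) stepsQ) (reversePath-involutive P tree v (suc j) below-root))

  forwardTree-InR : InR n (suc k) (i ∸ 1) (suc m) (forwardTree P)
  forwardTree-InR = subst (InR n (suc k) (i ∸ 1) (suc m)) (sym forwardTree≡Q)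
    (Q-isTree , improperCountQ , pathProperCountQ , degQ-v , degQ-1 , lambdaGt1-intro Q v lamQ a≢1)

  backward∘forward : backwardTree (forwardTree P) ≡ P
  backward∘forward = trans (cong backwardTree forwardTree≡Q) backwardTree-Q

stepsTo-∃ : ∀ {n} (S : Parents (suc n)) → T (isTree S) → ∀ {b u} →
  Critical.βnode S (fromℕ n) ≡ just b → Critical.lam S (fromℕ n) ≡ just u → ∃ λ s′ → stepsTo S u (fromℕ n) ≡ just (suc s′)
stepsTo-∃ {n} S tree {b} {u} βb lam≡u =
  let on-path = IsLowerCritical.on-path (isLambda⁻ {b} {u} (lam-just⁻ βb lam≡u))
      t , t≤N , ut≡v = Ancestor-≤N (desc⇒Ancestor {fromℕ n} {u} (OnCriticalPath.below-v on-path))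
      s , steps = findFirst-∃ (λ t → iter S t u == fromℕ n) (suc (suc n)) (≡⇒== ut≡v) (s≤s t≤N)
  in positive s steps (OnCriticalPath.≢v on-path)
  where
  open RootedTree S tree
  open LowerCriticalNode S tree (fromℕ n)
  positive : ∀ s → stepsTo S u (fromℕ n) ≡ just s → u ≢ fromℕ n → ∃ λ s′ → stepsTo S u (fromℕ n) ≡ just (suc s′)
  positive zero steps u≢v = ⊥-elim (u≢v (==⇒≡ (proj₁ (findFirst-just⇒least (λ t → iter S t u == fromℕ n) (suc (suc n)) steps))))
  positive (suc s′) steps _ = s′ , steps

module Backward {n k i m : ℕ} (i≥1 : 1 ≤ i) (m≥1 : 1 ≤ m) (S : Parents (suc n)) (tree : T (isTree S))
                (improper≡1+k : improperCount S ≡ suc k) (pathProper≡i∸1 : pathProperCount S (fromℕ n) ≡ i ∸ 1)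
                (deg-v≡1+m : deg S (fromℕ n) ≡ suc m) (deg-1≡0 : deg S fzero ≡ 0)
                (u : Fin (suc n)) (lam≡u : Critical.lam S (fromℕ n) ≡ just u) (u≢1 : u ≢ fzero)
                (b : Fin (suc n)) (βb : Critical.βnode S (fromℕ n) ≡ just b)
                (s′ : ℕ) (steps : stepsTo S u (fromℕ n) ≡ just (suc s′)) where

  open RootedTree S tree
  open LowerCriticalNode S tree (fromℕ n)
  open Critical S (fromℕ n) using (critical)

  private
    N : ℕ
    N = suc n
    v : Fin N
    v = fromℕ n
    s : ℕ
    s = suc s′
    s-least : T (iter S s u == v) × s < suc N × (∀ t → t < s → ¬ T (iter S t u == v))
    s-least = findFirst-just⇒least (λ t → iter S t u == v) (suc N) steps

  u-lower-critical : IsLowerCritical b u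
  u-lower-critical = isLambda⁻ (lam-just⁻ βb lam≡u)

  open IsLowerCritical u-lower-critical
  open OnCriticalPath on-path

  us≡v : iter S s u ≡ v
  us≡v = ==⇒≡ (proj₁ s-least)

  below-root : ∀ t → t < s → T (nonRoot S (iter S t u))
  below-root t t<s = ≢root⇒nonRoot λ ut≡root → proj₂ (proj₂ s-least) t t<s (≡⇒== (trans ut≡root (sym (v≡root ut≡root))))
    where
    v≡root : iter S t u ≡ root → v ≡ root
    v≡root ut≡root = trans (sym us≡v) (trans (sym (iter-∸ S u (<⇒≤ t<s))) (trans (cong (iter S (s ∸ t)) ut≡root) (iter-root (s ∸ t))))

  open PathReversal S tree u s below-root

  backwardTree≡Q : backwardTree S ≡ Q
  backwardTree≡Q = trans (cong (maybe′ _ S) lam≡u) (cong (maybe′ (reversePath S u) S) steps)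

  x-below-v : ∀ {t} → t ≤ s → T (desc S v (x t))
  x-below-v {t} t≤s = subst (λ w → T (desc S w (x t))) us≡v (Ancestor⇒desc (x-Ancestor t≤s))

  x∉T-u : ∀ {t} → 1 ≤ t → t ≤ s → ¬ T (desc S u (x t))
  x∉T-u {t} 1≤t t≤s h = <⇒≱ 1≤t (x-Ancestor⁻ {0} {t} z≤n t≤s (desc⇒Ancestor {u} {x t} h))

  v∉T-x : ∀ {t} → t < s → ¬ T (desc S (x t) v)
  v∉T-x {t} t<s h = <⇒≱ t<s (x-Ancestor⁻ {t} {s} (<⇒≤ t<s) ≤-refl (desc⇒Ancestor {x t} {a} (subst (T ∘ desc S (x t)) (sym us≡v) h)))

  u<x : ∀ {t} → 1 ≤ t → t ≤ s → toℕ u < toℕ (x t)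
  u<x 1≤t t≤s = critical⁻ is-critical (x-below-v t≤s) (x∉T-u 1≤t t≤s)

  x-not-critical : ∀ {t} → 1 ≤ t → t < s → ¬ T (critical (x t))
  x-not-critical {t} 1≤t t<s = topmost (x t) on-x-path xt≢u (Ancestor⇒desc (x-Ancestor {t} {0} z≤n))
    where
    xt≢u : x t ≢ u
    xt≢u xt≡u = <⇒≢ 1≤t (sym (x-injective (<⇒≤ t<s) z≤n xt≡u))
    on-x-path : OnCriticalPath b (x t)
    on-x-path = record
      { below-v = x-below-v (<⇒≤ t<s)
      ; ≢v = λ xt≡v → <⇒≢ t<s (x-injective (<⇒≤ t<s) ≤-refl (trans xt≡v (sym us≡v)))
      ; above-b = Ancestor⇒desc (Ancestor-trans S (x-Ancestor {t} {0} z≤n) (desc⇒Ancestor {u} {b} above-b))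
      }

  improper-x : ∀ {t} → t < s → ¬ T (proper S (x t))
  improper-x {t} t<s h = <-irrefl refl (<-≤-trans (<ᵇ⇒< _ _ h) (≤-trans β-xt≤u (<⇒≤ (u<x (s≤s z≤n) t<s))))
    where
    β-xt≤u : β S (x t) ≤ toℕ u
    β-xt≤u = minLabel-≤ S (desc S (x t)) (Ancestor⇒desc (x-Ancestor {t} {0} z≤n))

  properQ-x₁ : T (proper Q (x 1))
  properQ-x₁ = subst T (sym (properQ-x z<s)) (<ᵇ-minLabel⁺ S _ (toℕ<n u) λ y h →
    critical⁻ is-critical (subst (λ w → T (desc S w y)) us≡v (∧-elimˡ h)) (not-elim (∧-elimʳ {desc S a y} h)))

  improperQ-x : ∀ {t} → 1 ≤ t → t < s → ¬ T (proper Q (x (suc t)))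
  improperQ-x {t} 1≤t t<s h =
    let y , y∈T-v , y∉T-xt , y≤xt = ¬critical⇒∃ {x t} (x-not-critical 1≤t t<s)
        xt<y = <ᵇ-minLabel⁻ S (λ y → desc S a y ∧ not (desc S (x t) y)) {toℕ (x t)} {y} (subst T (properQ-x t<s) h)
                 (∧-intro (subst (λ w → T (desc S w y)) (sym us≡v) y∈T-v) (not-intro y∉T-xt))
    in <-irrefl refl (<-≤-trans xt<y y≤xt)

  improperCountQ : improperCount Q ≡ k
  improperCountQ = +-cancelʳ-≡ (s + e) _ _ (begin
    improperCount Q + (s + e)    ≡⟨ cong (improperCount Q +_) old ⟨
    improperCount Q + oldSum     ≡⟨ count-reversal (isImproper S) (isImproper Q) agree-off ⟩
    improperCount S + newSum     ≡⟨ cong₂ _+_ improper≡1+k new ⟩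
    suc k + (e + s′)             ≡⟨ cong (λ z → suc (k + z)) (+-comm e s′) ⟩
    suc (k + (s′ + e))           ≡⟨ +-suc k (s′ + e) ⟨
    k + (s + e)                  ∎)
    where
    e oldSum newSum : ℕ
    e = indicator (isImproper S a)
    oldSum = sumUpTo (indicator ∘ isImproper S ∘ x) s
    newSum = sumUpTo (indicator ∘ isImproper Q ∘ x) s
    agree-off : ∀ {y} → ¬ OnPath y → isImproper Q y ≡ isImproper S y
    agree-off off = cong₂ _∧_ (nonRootQ-off off) (cong not (properQ-off off))
    old : oldSum ≡ s + e
    old = cong (_+ e) (sumUpTo-ones _ s′ λ t t≤s′ → indicator-true (∧-intro (below-root t (s≤s t≤s′)) (not-intro (improper-x (s≤s t≤s′)))))
    new : newSum ≡ e + s′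
    new = trans (sumUpTo-shift _ s′) (cong₂ _+_ (cong indicator (edgeQ-start not))
      (sumUpTo-0-then-ones _ s′ (indicator-false λ h → not-elim (∧-elimʳ {nonRoot Q (x 1)} h) properQ-x₁)
        λ t 1≤t t≤s′ → indicator-true (∧-intro (nonRootQ-x (s≤s t≤s′)) (not-intro (improperQ-x 1≤t (s≤s t≤s′))))))

  pathProperCountQ : pathProperCount Q v ≡ i
  pathProperCountQ = +-cancelʳ-≡ (0 + p) _ _ (begin
    pathProperCount Q v + (0 + p)    ≡⟨ cong (pathProperCount Q v +_) old ⟨
    pathProperCount Q v + oldSum     ≡⟨ count-reversal (isProperOnPathFrom S v) (isProperOnPathFrom Q v) agree-off ⟩
    pathProperCount S v + newSum     ≡⟨ cong₂ _+_ pathProper≡i∸1 new ⟩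
    i ∸ 1 + (p + 1)                  ≡⟨ cong (i ∸ 1 +_) (+-comm p 1) ⟩
    i ∸ 1 + (1 + p)                  ≡⟨ +-assoc (i ∸ 1) 1 p ⟨
    (i ∸ 1 + 1) + p                  ≡⟨ cong (_+ p) (m∸n+n≡m i≥1) ⟩
    i + (0 + p)                      ∎)
    where
    p oldSum newSum : ℕ
    p = indicator (hasProperEdge S a)
    oldSum = sumUpTo (indicator ∘ isProperOnPathFrom S v ∘ x) s
    newSum = sumUpTo (indicator ∘ isProperOnPathFrom Q v ∘ x) s
    agree-off : ∀ {y} → ¬ OnPath y → isProperOnPathFrom Q v y ≡ isProperOnPathFrom S v y
    agree-off off = cong₂ _∧_ (nonRootQ-off off) (cong₂ _∧_ (descQ-off off v) (properQ-off off))
    a-above-v : T (desc S a v)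
    a-above-v = subst (T ∘ desc S a) us≡v (Ancestor⇒desc (Ancestor-refl S a))
    old : oldSum ≡ 0 + p
    old = cong₂ _+_ (sumUpTo-zeros _ s′ λ t t≤s′ → indicator-false λ h → v∉T-x (s≤s t≤s′) (∧-elimˡ (∧-elimʳ {nonRoot S (x t)} h)))
      (cong (λ z → indicator (nonRoot S a ∧ (z ∧ proper S a))) (T⇒≡true a-above-v))
    new : newSum ≡ p + 1
    new = trans (sumUpTo-shift _ s′) (cong₂ _+_ start
      (sumUpTo-1-then-zeros _ s′ (indicator-true (∧-intro (nonRootQ-x z<s) (∧-intro v-below-x₁ properQ-x₁)))
        λ t 1≤t t≤s′ → indicator-false λ h → improperQ-x 1≤t (s≤s t≤s′)
          (∧-elimʳ {desc Q (x (suc t)) v} (∧-elimʳ {nonRoot Q (x (suc t))} h))))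
      where
      start : indicator (isProperOnPathFrom Q v u) ≡ p
      start = cong indicator (trans (cong (λ z → nonRoot Q u ∧ (z ∧ proper Q u)) (trans (descQ-start v) (T⇒≡true a-above-v))) (edgeQ-start id))
      v-below-x₁ : T (desc Q (x 1) v)
      v-below-x₁ = subst T (sym (descQ-x z<s v)) (∧-intro a-above-v (not-intro (v∉T-x z<s)))

  degQ-v : deg Q v ≡ m
  degQ-v = +-cancelʳ-≡ (1 + 0) _ _ (begin
    deg Q v + (1 + 0)    ≡⟨ cong (deg Q v +_) old ⟨
    deg Q v + oldSum     ≡⟨ count-reversal (isChild S v) (isChild Q v) agree-off ⟩
    deg S v + newSum     ≡⟨ cong₂ _+_ deg-v≡1+m new ⟩
    suc m + (0 + 0)      ≡⟨ trans (+-identityʳ (suc m)) (+-comm 1 m) ⟩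
    m + (1 + 0)          ∎)
    where
    oldSum newSum : ℕ
    oldSum = sumUpTo (indicator ∘ isChild S v ∘ x) s
    newSum = sumUpTo (indicator ∘ isChild Q v ∘ x) s
    agree-off : ∀ {y} → ¬ OnPath y → isChild Q v y ≡ isChild S v y
    agree-off off = cong₂ _∧_ (nonRootQ-off off) (cong (_== v) (parQ-off off))
    old : oldSum ≡ 1 + 0
    old = cong₂ _+_
      (sumUpTo-zeros-then-1 _ s′ (λ t t<s′ → indicator-false λ h → x-distinct (s≤s t<s′) ≤-refl (trans (==⇒≡ (∧-elimʳ {nonRoot S (x t)} h)) (sym us≡v)))
        (indicator-true (∧-intro (below-root s′ ≤-refl) (≡⇒== us≡v))))
      (indicator-false (subst (λ w → ¬ T (isChild S v w)) (sym us≡v) (¬isChild-self S v)))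
    new : newSum ≡ 0 + 0
    new = trans (sumUpTo-shift _ s′) (cong₂ _+_ (indicator-false no-edge-to-v)
      (sumUpTo-zeros _ s′ λ t t≤s′ → indicator-false λ h → x-distinct (s≤s t≤s′) ≤-refl
        (trans (sym (parQ-x (s≤s t≤s′))) (trans (==⇒≡ (∧-elimʳ {nonRoot Q (x (suc t))} h)) (sym us≡v)))))
      where
      no-edge-to-v : ¬ T (isChild Q v u)
      no-edge-to-v h = nonRoot⇒par≢ a-nonRoot (trans (sym (trans parQ-start (top-nonRoot a-nonRoot))) (trans (==⇒≡ (∧-elimʳ {nonRoot Q u} h)) (sym us≡v)))
        where
        a-nonRoot : T (nonRoot S a)
        a-nonRoot = subst T nonRootQ-start (∧-elimˡ h)

  degQ-1 : deg Q fzero ≡ 0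
  degQ-1 = count-none (isChild Q fzero) (childlessQ u≢1 (count≡0⇒¬ (isChild S fzero) deg-1≡0))

  module LQ = LowerCriticalNode Q Q-isTree v

  βnodeQ≢v : ∀ {b′} → Critical.βnode Q v ≡ just b′ → b′ ≢ v
  βnodeQ≢v {b′} βb′ refl =
    let y , h = count≢0⇒∃ (isChild Q v) (λ c≡0 → <⇒≢ m≥1 (sym (trans (sym degQ-v) c≡0)))
        y-below-v = Q-tree.Ancestor⇒desc {v} {y} (1 , ==⇒≡ (∧-elimʳ {nonRoot Q y} h))
        y<v = ≤∧≢⇒< (≤fromℕ y) λ eq → ¬isChild-self Q v (subst (T ∘ isChild Q v) (toℕ-injective eq) h)
    in <-irrefl refl (<-≤-trans y<v (proj₂ (LQ.βnode-least {v} βb′) y y-below-v))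

  λQ≢1 : ∀ {b′ u′} → Critical.βnode Q v ≡ just b′ → T (Critical.isLambda Q v b′ u′) → u′ ≢ fzero
  λQ≢1 {b′} {u′} βb′ λu′ u′≡1 = not-elim (∧-elimʳ {desc S a fzero} 1∈T-a∖T-xs′) 1∈T-xs′
    where
    1∈Q-v : T (desc Q v fzero)
    1∈Q-v = subst (T ∘ desc Q v) u′≡1 (LQ.OnCriticalPath.below-v (LQ.IsLowerCritical.on-path (LQ.isLambda⁻ {b′} {u′} λu′)))
    1∈T-a∖T-xs′ : T (desc S a fzero ∧ not (desc S (x s′) fzero))
    1∈T-a∖T-xs′ = subst T (descQ-x ≤-refl fzero) (subst (λ w → T (desc Q w fzero)) (sym us≡v) 1∈Q-v)
    b≡1 : b ≡ fzero
    b≡1 = toℕ-injective (n≤0⇒n≡0 (proj₂ (βnode-least βb) fzero (subst (λ w → T (desc S w fzero)) us≡v (∧-elimˡ 1∈T-a∖T-xs′))))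
    1∈T-xs′ : T (desc S (x s′) fzero)
    1∈T-xs′ = subst (T ∘ desc S (x s′)) b≡1 (Ancestor⇒desc (Ancestor-trans S (x-Ancestor {s′} {0} z≤n) (desc⇒Ancestor {u} {b} above-b)))

  lambdaGt1Q : T (lambdaGt1 Q v)
  lambdaGt1Q =
    let b′ , βb′ = LQ.βnode-∃
        u′ , lam≡u′ , λu′ = LQ.lam-∃ βb′ (βnodeQ≢v βb′)
    in lambdaGt1-intro Q v lam≡u′ (λQ≢1 βb′ λu′)

  firstProperStepQ : firstProperStep Q ≡ just s′
  firstProperStepQ = findFirst-least⇒just (λ t → hasProperEdge Q (iter Q t v)) N found (≤-pred (proj₁ (proj₂ s-least))) before
    where
    Qv≡x : ∀ {t} → t ≤ s → iter Q t v ≡ x (s ∸ t)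
    Qv≡x {t} t≤s = trans (cong (iter Q t) (sym us≡v)) (iterQ-a t≤s)
    found : T (hasProperEdge Q (iter Q s′ v))
    found = subst (T ∘ hasProperEdge Q) (sym (trans (Qv≡x (n≤1+n s′)) (cong x (m+n∸n≡m 1 s′)))) (∧-intro (nonRootQ-x z<s) properQ-x₁)
    before : ∀ t → t < s′ → ¬ T (hasProperEdge Q (iter Q t v))
    before t t<s′ h = improperQ-x {s′ ∸ t} (m<n⇒0<n∸m t<s′) (s≤s (m∸n≤m s′ t))
      (∧-elimʳ {nonRoot Q (x (suc (s′ ∸ t)))} (subst (T ∘ hasProperEdge Q) (trans (Qv≡x (m≤n⇒m≤1+n (<⇒≤ t<s′))) (cong x (+-∸-assoc 1 (<⇒≤ t<s′)))) h))

  forwardTree-Q : forwardTree Q ≡ S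
  forwardTree-Q = trans (cong (maybe′ _ Q) firstProperStepQ)
    (trans (cong (λ w → reversePath Q w s) (sym us≡v)) (reversePath-involutive S tree u s below-root))

  backwardTree-InR : InR n k i m (backwardTree S)
  backwardTree-InR = subst (InR n k i m) (sym backwardTree≡Q)
    (Q-isTree , improperCountQ , pathProperCountQ , degQ-v , degQ-1 , lambdaGt1Q)

  forward∘backward : forwardTree (backwardTree S) ≡ S
  forward∘backward = trans (cong forwardTree backwardTree≡Q) forwardTree-Q

module _ {n k i m : ℕ} (i≥1 : 1 ≤ i) (m≥1 : 1 ≤ m) where

  forward-InR : ∀ {P} → InR n k i m P → InR n (suc k) (i ∸ 1) (suc m) (forwardTree P)
  forward-InR {P} (tree , c₁ , c₂ , c₃ , c₄ , _) =
    let j , j-first = firstProperStep-∃ P tree i≥1 c₂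
    in Forward.forwardTree-InR i≥1 m≥1 P tree c₁ c₂ c₃ c₄ j j-first

  backward∘forward : ∀ {P} → InR n k i m P → backwardTree (forwardTree P) ≡ P
  backward∘forward {P} (tree , c₁ , c₂ , c₃ , c₄ , _) =
    let j , j-first = firstProperStep-∃ P tree i≥1 c₂
    in Forward.backward∘forward i≥1 m≥1 P tree c₁ c₂ c₃ c₄ j j-first

  backward-InR : ∀ {S} → InR n (suc k) (i ∸ 1) (suc m) S → InR n k i m (backwardTree S)
  backward-InR {S} (tree , c₁ , c₂ , c₃ , c₄ , λ>1) =
    let u , lam≡u , u≢1 = lambdaGt1-elim S (fromℕ n) λ>1
        b , βb = LowerCriticalNode.βnode-∃ S tree (fromℕ n)
        s′ , steps = stepsTo-∃ S tree βb lam≡u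
    in Backward.backwardTree-InR i≥1 m≥1 S tree c₁ c₂ c₃ c₄ u lam≡u u≢1 b βb s′ steps

  forward∘backward : ∀ {S} → InR n (suc k) (i ∸ 1) (suc m) S → forwardTree (backwardTree S) ≡ S
  forward∘backward {S} (tree , c₁ , c₂ , c₃ , c₄ , λ>1) =
    let u , lam≡u , u≢1 = lambdaGt1-elim S (fromℕ n) λ>1
        b , βb = LowerCriticalNode.βnode-∃ S tree (fromℕ n)
        s′ , steps = stepsTo-∃ S tree βb lam≡u
    in Backward.forward∘backward i≥1 m≥1 S tree c₁ c₂ c₃ c₄ u lam≡u u≢1 b βb s′ steps

InR-irrelevant : ∀ {n k i m P} (p q : InR n k i m P) → p ≡ q
InR-irrelevant (a₁ , a₂ , a₃ , a₄ , a₅ , a₆) (b₁ , b₂ , b₃ , b₄ , b₅ , b₆)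
  rewrite T-irrelevant a₁ b₁ | ≡-irrelevant a₂ b₂ | ≡-irrelevant a₃ b₃
        | ≡-irrelevant a₄ b₄ | ≡-irrelevant a₅ b₅ | T-irrelevant a₆ b₆ = refl

R-≡ : ∀ {n k i m} {x y : R n k i m} → proj₁ x ≡ proj₁ y → x ≡ y
R-≡ {n} {k} {i} {m} {P , p} {.P , q} refl = cong (P ,_) (InR-irrelevant {n} {k} {i} {m} {P} p q)

lemma3p4 : (n k i m : ℕ) → 1 ≤ i → 1 ≤ m →
    R n k i m ⤖ R n (suc k) (i ∸ 1) (suc m)
lemma3p4 n k i m i≥1 m≥1 = ↔⇒⤖ (mk↔ₛ′ to from to∘from from∘to)
  where
  to : R n k i m → R n (suc k) (i ∸ 1) (suc m)
  to (P , p) = forwardTree P , forward-InR i≥1 m≥1 {P} p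
  from : R n (suc k) (i ∸ 1) (suc m) → R n k i m
  from (S , p) = backwardTree S , backward-InR i≥1 m≥1 {S} p
  to∘from : ∀ y → to (from y) ≡ y
  to∘from (S , p) = R-≡ {x = to (from (S , p))} {S , p} (forward∘backward i≥1 m≥1 {S} p)
  from∘to : ∀ x → from (to x) ≡ x
  from∘to (P , p) = R-≡ {x = from (to (P , p))} {P , p} (backward∘forward i≥1 m≥1 {P} p)
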